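{- Let $p>3$ be a prime and for positive integers $n$ and integers $0\le k\le n$ let $$G(n,k)=\frac{n^2\binom{2n}{n}\binom{2n+2k}{n+k}\binom{2n-2k}{n-k}\binom{n+k}{n}}{2^{8n-2k-4}(2n+2k-1)\binom{2k}{k}}.$$ Then $$G\!\left(p,\tfrac{p+1}{2}\right)\equiv(-1)^{(p-1)/2}p\left(1-3pq_p(2)+6p^2q_p(2)^2\right)\pmod{p^4}.$$
   Context: $q_p(2)=(2^{p-1}-1)/p$ is the Fermat quotient. Congruences between rational numbers are understood in the ring of rationals whose denominators are coprime to $p$. -}

module Defs where

open import Data.Nat as ℕ using (ℕ; zero; suc; _+_; _*_; _∸_; _^_; _≤_; _<_; z≤n; s≤s; NonZero)
open import Data.Nat.Properties
open import Data.Nat.Combinatorics using (_C_; nCk+nC[k+1]≡[n+1]C[k+1])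
open import Data.Nat.Coprimality using (Coprime)
open import Data.Integer as ℤ using (ℤ; +_)
open import Data.Rational as ℚ using (ℚ; _/_)
open import Data.Product using (Σ; _×_)
open import Relation.Binary.PropositionalEquality using (_≡_; refl; subst; sym)

nCk>0 : ∀ n k → k ≤ n → 0 < n C k
nCk>0 n zero _ = s≤s z≤n
nCk>0 (suc n) (suc k) (s≤s k≤n) =
  subst (0 <_) (nCk+nC[k+1]≡[n+1]C[k+1] n k)
        (<-≤-trans (nCk>0 n k k≤n) (m≤m+n (n C k) (n C suc k)))

Gden : ℕ → ℕ → ℕ
Gden n k = 2 ^ (8 * n ∸ 2 * k ∸ 4) * (2 * n + 2 * k ∸ 1) * ((2 * k) C k)

Gnum : ℕ → ℕ → ℕ
Gnum n k = n ^ 2 * ((2 * n) C n) * ((2 * n + 2 * k) C (n + k))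
             * ((2 * n ∸ 2 * k) C (n ∸ k)) * ((n + k) C n)

Gden-nonZero : ∀ n k → .{{NonZero n}} → NonZero (Gden n k)
Gden-nonZero (suc m) k =
  m*n≢0 (2 ^ (8 * suc m ∸ 2 * k ∸ 4) * (2 * suc m + 2 * k ∸ 1)) ((2 * k) C k)
    {{m*n≢0 (2 ^ (8 * suc m ∸ 2 * k ∸ 4)) (2 * suc m + 2 * k ∸ 1)
       {{m^n≢0 2 (8 * suc m ∸ 2 * k ∸ 4)}}
       {{ℕ.>-nonZero (≤-trans (s≤s z≤n) (∸-monoˡ-≤ {2} {2 * suc m + 2 * k} 1
            (≤-trans (*-monoʳ-≤ 2 (s≤s z≤n)) (m≤m+n (2 * suc m) (2 * k)))))}}}}
    {{ℕ.>-nonZero (nCk>0 (2 * k) k (m≤m+n k (k + 0)))}}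

G : (n k : ℕ) → .{{NonZero n}} → ℚ
G n k = (+ Gnum n k / Gden n k) {{Gden-nonZero n k}}

qp2 : (p : ℕ) → .{{NonZero p}} → ℚ
qp2 p = + (2 ^ (p ∸ 1) ∸ 1) / p

ℤ→ℚ : ℤ → ℚ
ℤ→ℚ z = z / 1

ℕ→ℚ : ℕ → ℚ
ℕ→ℚ n = + n / 1

-- a ≡ b (mod p^e) in the ring of rationals with denominator coprime to p:
-- a - b = p^e * (u / v) with u ∈ ℤ, v ∈ ℕ coprime to p.
CongModPow : ℕ → ℕ → ℚ → ℚ → Set
CongModPow p e a b =
  Σ ℤ λ u → Σ ℕ λ v → Coprime v p ×
    ((a ℚ.- b) ℚ.* ℕ→ℚ v ≡ ℕ→ℚ (p ^ e) ℚ.* ℤ→ℚ u)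

module Submission where

-- Write p = 2m + 1 and k = m + 1. Expanding the binomial coefficients into factorials gives
-- G(p, k) = p F / Z, where F, Z are built from m!, 4^m and the blocks (ap + 1)⋯(ap + 2m)
-- and (p + 1)⋯(p + m), and p ∤ Z. Each block is ±Q(ip)Q(jp) with Q(y) = (y + 1)⋯(y + m),
-- and Q(jp) ≡ E(j) = A + jB + j²C (mod p³) with A = m!, p ∣ B, p² ∣ C. Splitting (x + 1)⋯(x + 2m)
-- into its odd and even factors at x = 0 and x = p gives two exact identities between values of Q and
-- of Q₂(y) = (y + 2)(y + 4)⋯(y + 2m). Modulo p³ they force T = 4^m ≡ 1 (mod p) and 2AC ≡ B², so that
-- E(i)E(j) ≡ A E(i + j): E(j) behaves like A T^(-2j). Hence F ≡ ±T⁶A⁶ and Z ≡ T⁹A⁶, i.e. F ≡ ±T⁻³ Z,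
-- and T = 1 + p q_p(2) turns T⁻³ into 1 − 3p q_p(2) + 6p² q_p(2)² modulo p³.

open import Data.Nat using (ℕ; _<_)
open import Data.Nat.Primality using (Prime)

module Congruence where

  open import Data.Nat as ℕ using (ℕ; zero; suc; NonZero; _<_; _^_; z≤n; s≤s)
  import Data.Nat.Properties as ℕ
  open import Data.Nat.Divisibility as ℕ using (divides; _∤_)
  open import Data.Nat.Primality using (Prime; euclidsLemma; prime⇒nonZero; prime⇒nonTrivial; prime⇒irreducible)
  open import Data.Nat.Coprimality using (Coprime)
  open import Data.Integer using (ℤ; +_; _+_; _*_; -_; _-_; ∣_∣; 0ℤ; 1ℤ)
  import Data.Integer.Properties as ℤ
  open import Data.Integer.Divisibility.Signed as ℤ using ()
  open import Data.Integer.Tactic.RingSolver using (solve-∀)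
  open import Data.Sum using (inj₁; inj₂)
  open import Data.Product using (_,_)
  open import Relation.Binary.PropositionalEquality
  open import Relation.Nullary using (contradiction)

  infix 4 _≡_[mod_]
  record _≡_[mod_] (x y n : ℤ) : Set where
    constructor by-multiple
    field
      multiple : ℤ
      equality : x ≡ y + multiple * n

  module _ {n : ℤ} where

    mod-refl : ∀ {x} → x ≡ x [mod n ]
    mod-refl {x} = by-multiple 0ℤ (lemma x n)
      where
        lemma : ∀ x n → x ≡ x + 0ℤ * n
        lemma = solve-∀

    mod-reflexive : ∀ {x y} → x ≡ y → x ≡ y [mod n ]
    mod-reflexive refl = mod-refl

    mod-sym : ∀ {x y} → x ≡ y [mod n ] → y ≡ x [mod n ]
    mod-sym {y = y} (by-multiple k refl) = by-multiple (- k) (lemma y k n)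
      where
        lemma : ∀ y k n → y ≡ (y + k * n) + (- k) * n
        lemma = solve-∀

    mod-trans : ∀ {x y z} → x ≡ y [mod n ] → y ≡ z [mod n ] → x ≡ z [mod n ]
    mod-trans {z = z} (by-multiple k refl) (by-multiple l refl) = by-multiple (k + l) (lemma z k l n)
      where
        lemma : ∀ z k l n → (z + l * n) + k * n ≡ z + (k + l) * n
        lemma = solve-∀

    mod-+ : ∀ {x y u v} → x ≡ y [mod n ] → u ≡ v [mod n ] → x + u ≡ y + v [mod n ]
    mod-+ {y = y} {v = v} (by-multiple k refl) (by-multiple l refl) =
      by-multiple (k + l) (lemma y v k l n)
      where
        lemma : ∀ y v k l n → (y + k * n) + (v + l * n) ≡ (y + v) + (k + l) * n
        lemma = solve-∀

    mod-* : ∀ {x y u v} → x ≡ y [mod n ] → u ≡ v [mod n ] → x * u ≡ y * v [mod n ]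
    mod-* {y = y} {v = v} (by-multiple k refl) (by-multiple l refl) =
      by-multiple (k * v + y * l + k * l * n) (lemma y v k l n)
      where
        lemma : ∀ y v k l n →
          (y + k * n) * (v + l * n) ≡ y * v + (k * v + y * l + k * l * n) * n
        lemma = solve-∀

    mod-difference : ∀ {x y} → x ≡ y [mod n ] → x - y ≡ 0ℤ [mod n ]
    mod-difference {y = y} (by-multiple k refl) = by-multiple k (lemma y k n)
      where
        lemma : ∀ y k n → (y + k * n) - y ≡ 0ℤ + k * n
        lemma = solve-∀

    multiple≡0 : ∀ k → k * n ≡ 0ℤ [mod n ]
    multiple≡0 k = by-multiple k (sym (ℤ.+-identityˡ (k * n)))

    mod-*ˡ : ∀ c {x y} → x ≡ y [mod n ] → c * x ≡ c * y [mod n ]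
    mod-*ˡ c = mod-* (mod-refl {c})

    mod-*ʳ : ∀ c {x y} → x ≡ y [mod n ] → x * c ≡ y * c [mod n ]
    mod-*ʳ c e = mod-* e (mod-refl {c})

    module mod-Reasoning where
      infix 1 begin_
      infixr 2 _≈⟨_⟩_ _≡⟨_⟩_ _≡⟨_⟨_
      infix 3 _∎

      begin_ : ∀ {x y} → x ≡ y [mod n ] → x ≡ y [mod n ]
      begin e = e

      _≈⟨_⟩_ : ∀ x {y z} → x ≡ y [mod n ] → y ≡ z [mod n ] → x ≡ z [mod n ]
      x ≈⟨ e ⟩ f = mod-trans e f

      _≡⟨_⟩_ : ∀ x {y z} → x ≡ y → y ≡ z [mod n ] → x ≡ z [mod n ]
      x ≡⟨ refl ⟩ f = f

      _≡⟨_⟨_ : ∀ x {y z} → y ≡ x → y ≡ z [mod n ] → x ≡ z [mod n ]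
      x ≡⟨ refl ⟨ f = f

      _∎ : ∀ x → x ≡ x [mod n ]
      x ∎ = mod-refl

  mod-weaken : ∀ {d n x y} → x ≡ y [mod d * n ] → x ≡ y [mod n ]
  mod-weaken {d} {n} {y = y} (by-multiple k e) =
    by-multiple (k * d) (trans e (cong (λ t → y + t) (sym (ℤ.*-assoc k d n))))

  module PrimeModulus {p : ℕ} (p-prime : Prime p) where

    instance
      p≢0 : NonZero p
      p≢0 = prime⇒nonZero p-prime

    ∤-* : ∀ {a b} → p ∤ a → p ∤ b → p ∤ a ℕ.* b
    ∤-* {a} {b} p∤a p∤b p∣ab with euclidsLemma a b p-prime p∣ab
    ... | inj₁ p∣a = p∤a p∣a
    ... | inj₂ p∣b = p∤b p∣b

    ∤-small : ∀ {n} → 0 < n → n < p → p ∤ n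
    ∤-small {n} 0<n n<p p∣n = ℕ.<⇒≱ n<p (ℕ.∣⇒≤ {{ℕ.>-nonZero 0<n}} p∣n)

    ∤1 : p ∤ 1
    ∤1 = ∤-small (s≤s z≤n) (ℕ.nonTrivial⇒n>1 p {{prime⇒nonTrivial p-prime}})

    ∤-^ : ∀ {a} → p ∤ a → ∀ n → p ∤ a ^ n
    ∤-^ p∤a zero = ∤1
    ∤-^ p∤a (suc n) = ∤-* p∤a (∤-^ p∤a n)

    ∤⇒coprime : ∀ {n} → p ∤ n → Coprime n p
    ∤⇒coprime p∤n (d∣n , d∣p) with prime⇒irreducible p-prime d∣p
    ... | inj₁ d≡1 = d≡1
    ... | inj₂ refl = contradiction d∣n p∤n

    ∤-∣*∣ : ∀ {a b} → p ∤ ∣ a ∣ → p ∤ ∣ b ∣ → p ∤ ∣ a * b ∣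
    ∤-∣*∣ {a} {b} p∤a p∤b = subst (p ∤_) (sym (ℤ.abs-* a b)) (∤-* p∤a p∤b)

    ^∣-cancelˡ : ∀ k {a b} → p ∤ a → p ℕ.^ k ℕ.∣ a ℕ.* b → p ℕ.^ k ℕ.∣ b
    ^∣-cancelˡ zero _ _ = ℕ.1∣ _
    ^∣-cancelˡ (suc k) {a} {b} p∤a pᵏ⁺¹∣ab
      with euclidsLemma a b p-prime (ℕ.∣-trans (ℕ.m∣m*n (p ℕ.^ k)) pᵏ⁺¹∣ab)
    ... | inj₁ p∣a = contradiction p∣a p∤a
    ... | inj₂ (divides c refl) =
      subst (p ℕ.^ suc k ℕ.∣_) (ℕ.*-comm p c) (ℕ.*-monoʳ-∣ p pᵏ∣c)
      where
        rearrange : a ℕ.* (c ℕ.* p) ≡ p ℕ.* (a ℕ.* c)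
        rearrange = trans (sym (ℕ.*-assoc a c p)) (ℕ.*-comm (a ℕ.* c) p)
        pᵏ∣c : p ℕ.^ k ℕ.∣ c
        pᵏ∣c = ^∣-cancelˡ k p∤a (ℕ.*-cancelˡ-∣ p (subst (p ℕ.^ suc k ℕ.∣_) rearrange pᵏ⁺¹∣ab))

    mod-p^-cancelˡ : ∀ k {a x y} → p ∤ ∣ a ∣ →
                     a * x ≡ a * y [mod + (p ℕ.^ k) ] → x ≡ y [mod + (p ℕ.^ k) ]
    mod-p^-cancelˡ k {a} {x} {y} p∤a (by-multiple c e) =
      by-multiple (ℤ._∣_.quotient pᵏ∣x-y) (trans (split x y) (cong (λ t → y + t) (ℤ._∣_.equality pᵏ∣x-y)))
      where
        pᵏ = + (p ℕ.^ k)
        split : ∀ x y → x ≡ y + (x - y)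
        split = solve-∀
        distrib : ∀ a x y → a * (x - y) ≡ a * x - a * y
        distrib = solve-∀
        cancel : ∀ u v → (u + v) - u ≡ v
        cancel = solve-∀
        a[x-y]≡cpᵏ : a * (x - y) ≡ c * pᵏ
        a[x-y]≡cpᵏ = trans (distrib a x y) (trans (cong (_- a * y) e) (cancel (a * y) (c * pᵏ)))
        pᵏ∣∣a∣∣x-y∣ : p ℕ.^ k ℕ.∣ ∣ a ∣ ℕ.* ∣ x - y ∣
        pᵏ∣∣a∣∣x-y∣ = subst (p ℕ.^ k ℕ.∣_) (trans (cong ∣_∣ (sym a[x-y]≡cpᵏ)) (ℤ.abs-* a (x - y)))
                        (subst (p ℕ.^ k ℕ.∣_) (sym (ℤ.abs-* c pᵏ)) (ℕ.n∣m*n ∣ c ∣))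
        pᵏ∣x-y : pᵏ ℤ.∣ (x - y)
        pᵏ∣x-y = ℤ.∣ᵤ⇒∣ (^∣-cancelˡ k p∤a pᵏ∣∣a∣∣x-y∣)

    ∤-mod : ∀ {a b} → a ≡ b [mod + p ] → p ∤ ∣ b ∣ → p ∤ ∣ a ∣
    ∤-mod {a} {b} (by-multiple k refl) p∤b p∣a =
      p∤b (ℤ.∣⇒∣ᵤ (subst (+ p ℤ.∣_) (cancel b (k * + p))
        (ℤ.∣m∣n⇒∣m-n {m = b + k * + p} (ℤ.∣ᵤ⇒∣ p∣a) (ℤ.∣n⇒∣m*n k (ℤ.∣-refl {+ p})))))
      where
        cancel : ∀ u v → (u + v) - v ≡ u
        cancel = solve-∀

  module QuadraticForm (A B C : ℤ) where

    E : ℤ → ℤ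
    E k = A + k * B + k * k * C

    -- E½ k = 4 E (k / 2), written without division.
    E½ : ℤ → ℤ
    E½ k = + 4 * A + + 2 * k * B + k * k * C

    module _ {n : ℤ} (disc≡0 : + 2 * A * C - B * B ≡ 0ℤ [mod n ])
             (BC≡0 : B * C ≡ 0ℤ [mod n ]) (CC≡0 : C * C ≡ 0ℤ [mod n ]) where

      private
        annihilate : ∀ a u v w → a + u * (+ 2 * A * C - B * B) + v * (B * C) + w * (C * C) ≡ a [mod n ]
        annihilate a u v w = begin
          a + u * (+ 2 * A * C - B * B) + v * (B * C) + w * (C * C)
            ≈⟨ mod-+ (mod-+ (mod-+ (mod-refl {x = a}) (mod-*ˡ u disc≡0)) (mod-*ˡ v BC≡0)) (mod-*ˡ w CC≡0) ⟩
          a + u * 0ℤ + v * 0ℤ + w * 0ℤ ≡⟨ vanish a u v w ⟩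
          a ∎
          where
            open mod-Reasoning
            vanish : ∀ a u v w → a + u * 0ℤ + v * 0ℤ + w * 0ℤ ≡ a
            vanish = solve-∀

      E-multiplicative : ∀ k l → E k * E l ≡ A * E (k + l) [mod n ]
      E-multiplicative k l = mod-trans (mod-reflexive (expand A B C k l))
                                       (annihilate (A * E (k + l)) (- (k * l)) (k * l * (k + l)) (k * k * l * l))
        where
          expand : ∀ A B C k l → (A + k * B + k * k * C) * (A + l * B + l * l * C)
                 ≡ A * (A + (k + l) * B + (k + l) * (k + l) * C) + (- (k * l)) * (+ 2 * A * C - B * B)
                   + k * l * (k + l) * (B * C) + k * k * l * l * (C * C)
          expand = solve-∀

      E½-square : ∀ k → E½ k * E½ k ≡ + 16 * A * E k [mod n ]
      E½-square k = mod-trans (mod-reflexive (expand A B C k))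
                              (annihilate (+ 16 * A * E k) (- (+ 4 * k * k)) (+ 4 * k * k * k) (k * k * k * k))
        where
          expand : ∀ A B C k → (+ 4 * A + + 2 * k * B + k * k * C) * (+ 4 * A + + 2 * k * B + k * k * C)
                 ≡ + 16 * A * (A + k * B + k * k * C) + (- (+ 4 * k * k)) * (+ 2 * A * C - B * B)
                   + + 4 * k * k * k * (B * C) + k * k * k * k * (C * C)
          expand = solve-∀

  cube-inverse : ∀ {n t} → t ≡ 0ℤ [mod n ] →
                 (1ℤ - + 3 * t + + 6 * (t * t)) * ((1ℤ + t) * (1ℤ + t) * (1ℤ + t)) ≡ 1ℤ [mod n * n * n ]
  cube-inverse {n} (by-multiple k refl) = by-multiple (k * k * k * (+ 10 + + 15 * t + + 6 * (t * t))) (expand k n)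
    where
      t = 0ℤ + k * n
      expand : ∀ k n → let t = 0ℤ + k * n in (1ℤ - + 3 * t + + 6 * (t * t)) * ((1ℤ + t) * (1ℤ + t) * (1ℤ + t))
             ≡ 1ℤ + k * k * k * (+ 10 + + 15 * t + + 6 * (t * t)) * (n * n * n)
      expand = solve-∀

module Products where

  open import Data.Nat as ℕ using (ℕ; zero; suc; _∸_; _≤_; s≤s; z≤n)
  import Data.Nat.Properties as ℕ
  open import Data.Integer using (ℤ; _+_; _*_; _^_; 1ℤ; 0ℤ)
  import Data.Integer.Properties as ℤ
  open import Data.Integer.Tactic.RingSolver using (solve-∀)
  open import Data.Product using (Σ; _,_; _×_)
  open import Relation.Binary.PropositionalEquality

  ∏ : ℕ → (ℕ → ℤ) → ℤ
  ∏ zero    f = 1ℤ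
  ∏ (suc n) f = ∏ n f * f (suc n)

  ∏-cong : ∀ n {f g} → (∀ j → 1 ≤ j → j ≤ n → f j ≡ g j) → ∏ n f ≡ ∏ n g
  ∏-cong zero    f≗g = refl
  ∏-cong (suc n) f≗g = cong₂ _*_
    (∏-cong n (λ j 1≤j j≤n → f≗g j 1≤j (ℕ.m≤n⇒m≤1+n j≤n)))
    (f≗g (suc n) (s≤s z≤n) ℕ.≤-refl)

  ∏-suc : ∀ n f → ∏ (suc n) f ≡ f 1 * ∏ n (λ j → f (suc j))
  ∏-suc zero    f = ℤ.*-comm 1ℤ (f 1)
  ∏-suc (suc n) f = trans (cong (_* f (2 ℕ.+ n)) (∏-suc n f))
                          (ℤ.*-assoc (f 1) (∏ n (λ j → f (suc j))) (f (2 ℕ.+ n)))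

  ∏-reverse : ∀ n f → ∏ n f ≡ ∏ n (λ j → f (suc n ∸ j))
  ∏-reverse zero    f = refl
  ∏-reverse (suc n) f = begin
    ∏ n f * f (suc n)                           ≡⟨ cong (_* f (suc n)) (∏-reverse n f) ⟩
    ∏ n (λ j → f (suc n ∸ j)) * f (suc n)       ≡⟨ ℤ.*-comm _ (f (suc n)) ⟩
    f (suc n) * ∏ n (λ j → f (suc n ∸ j))       ≡⟨ ∏-suc n (λ j → f (2 ℕ.+ n ∸ j)) ⟨
    ∏ (suc n) (λ j → f (2 ℕ.+ n ∸ j))           ∎
    where open ≡-Reasoning

  ∏-+ : ∀ a b f → ∏ (a ℕ.+ b) f ≡ ∏ a f * ∏ b (λ j → f (a ℕ.+ j))
  ∏-+ a zero    f = trans (cong (λ n → ∏ n f) (ℕ.+-identityʳ a)) (sym (ℤ.*-identityʳ (∏ a f)))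
  ∏-+ a (suc b) f = begin
    ∏ (a ℕ.+ suc b) f                                     ≡⟨ cong (λ n → ∏ n f) (ℕ.+-suc a b) ⟩
    ∏ (a ℕ.+ b) f * f (suc (a ℕ.+ b))                     ≡⟨ cong (_* f (suc (a ℕ.+ b))) (∏-+ a b f) ⟩
    ∏ a f * ∏ b (λ j → f (a ℕ.+ j)) * f (suc (a ℕ.+ b))   ≡⟨ ℤ.*-assoc (∏ a f) _ _ ⟩
    ∏ a f * (∏ b (λ j → f (a ℕ.+ j)) * f (suc (a ℕ.+ b))) ≡⟨ cong (λ i → ∏ a f * (∏ b (λ j → f (a ℕ.+ j)) * f i)) (ℕ.+-suc a b) ⟨
    ∏ a f * ∏ (suc b) (λ j → f (a ℕ.+ j))                 ∎
    where open ≡-Reasoning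

  ∏-* : ∀ n f g → ∏ n (λ j → f j * g j) ≡ ∏ n f * ∏ n g
  ∏-* zero    f g = refl
  ∏-* (suc n) f g = trans (cong (_* (f (suc n) * g (suc n))) (∏-* n f g))
                          (interchange (∏ n f) (∏ n g) (f (suc n)) (g (suc n)))
    where
      interchange : ∀ a b c d → (a * b) * (c * d) ≡ (a * c) * (b * d)
      interchange = solve-∀

  ∏-const : ∀ n c → ∏ n (λ _ → c) ≡ c ^ n
  ∏-const zero    c = refl
  ∏-const (suc n) c = trans (cong (_* c) (∏-const n c)) (ℤ.*-comm (c ^ n) c)

  ∏-scale : ∀ n c f → ∏ n (λ j → c * f j) ≡ c ^ n * ∏ n f
  ∏-scale n c f = trans (∏-* n (λ _ → c) f) (cong (_* ∏ n f) (∏-const n c))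

  ∏-pairs : ∀ n f → ∏ (n ℕ.+ n) f ≡ ∏ n (λ i → f (i ℕ.+ i ∸ 1) * f (i ℕ.+ i))
  ∏-pairs zero    f = refl
  ∏-pairs (suc n) f = begin
    ∏ (suc n ℕ.+ suc n) f                         ≡⟨ cong (λ i → ∏ (suc i) f) (ℕ.+-suc n n) ⟩
    ∏ (n ℕ.+ n) f * f (suc (n ℕ.+ n)) * f (2 ℕ.+ (n ℕ.+ n))
                                                  ≡⟨ ℤ.*-assoc (∏ (n ℕ.+ n) f) _ _ ⟩
    ∏ (n ℕ.+ n) f * (f (suc (n ℕ.+ n)) * f (2 ℕ.+ (n ℕ.+ n)))
                                                  ≡⟨ cong (_* (f (suc (n ℕ.+ n)) * f (2 ℕ.+ (n ℕ.+ n)))) (∏-pairs n f) ⟩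
    ∏ n g * (f (suc (n ℕ.+ n)) * f (2 ℕ.+ (n ℕ.+ n)))
                                                  ≡⟨ cong (λ i → ∏ n g * (f (i ∸ 1) * f i)) (ℕ.+-suc (suc n) n) ⟨
    ∏ (suc n) g                                   ∎
    where
      open ≡-Reasoning
      g : ℕ → ℤ
      g i = f (i ℕ.+ i ∸ 1) * f (i ℕ.+ i)

  record Quadratic : Set where
    constructor quadratic
    field c₀ c₁ c₂ : ℤ
  open Quadratic public

  evalQuadratic : Quadratic → ℤ → ℤ
  evalQuadratic q y = c₀ q + c₁ q * y + c₂ q * (y * y)

  lowCoefficients : (ℕ → ℤ) → ℕ → Quadratic
  lowCoefficients f zero    = quadratic 1ℤ 0ℤ 0ℤ
  lowCoefficients f (suc n) = quadratic (b * c₀ q) (b * c₁ q + c₀ q) (b * c₂ q + c₁ q)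
    where
      q = lowCoefficients f n
      b = f (suc n)

  c₀-lowCoefficients : ∀ f n → c₀ (lowCoefficients f n) ≡ ∏ n f
  c₀-lowCoefficients f zero    = refl
  c₀-lowCoefficients f (suc n) =
    trans (cong (f (suc n) *_) (c₀-lowCoefficients f n)) (ℤ.*-comm (f (suc n)) (∏ n f))

  ∏-lowCoefficients : ∀ f n y →
    Σ ℤ λ r → ∏ n (λ j → y + f j) ≡ evalQuadratic (lowCoefficients f n) y + y * y * y * r
  ∏-lowCoefficients f zero    y = 0ℤ , empty y
    where
      empty : ∀ y → 1ℤ ≡ (1ℤ + 0ℤ * y + 0ℤ * (y * y)) + y * y * y * 0ℤ
      empty = solve-∀
  ∏-lowCoefficients f (suc n) y with ∏-lowCoefficients f n y
  ... | r , eq = c₂ q + b * r + y * r ,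
    trans (cong (_* (y + b)) eq) (step (c₀ q) (c₁ q) (c₂ q) b y r)
    where
      q = lowCoefficients f n
      b = f (suc n)
      step : ∀ a₀ a₁ a₂ b y r → (a₀ + a₁ * y + a₂ * (y * y) + y * y * y * r) * (y + b)
           ≡ (b * a₀ + (b * a₁ + a₀) * y + (b * a₂ + a₁) * (y * y)) + y * y * y * (a₂ + b * r + y * r)
      step = solve-∀

  -- The coefficient of yⁱ in ∏ (y + c fⱼ) is cⁿ⁻ⁱ times that in ∏ (y + fⱼ); multiplied by c² to avoid division.
  lowCoefficients-scale : ∀ c f n →
    let s = lowCoefficients (λ j → c * f j) n ; t = lowCoefficients f n in
    (c * c * c₀ s ≡ c ^ n * (c * c * c₀ t)) ×
    (c * c * c₁ s ≡ c ^ n * (c * c₁ t)) ×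
    (c * c * c₂ s ≡ c ^ n * c₂ t)
  lowCoefficients-scale c f zero    = base₀ c , base₁ c , base₂ c
    where
      base₀ : ∀ c → c * c * 1ℤ ≡ 1ℤ * (c * c * 1ℤ)
      base₀ = solve-∀
      base₁ : ∀ c → c * c * 0ℤ ≡ 1ℤ * (c * 0ℤ)
      base₁ = solve-∀
      base₂ : ∀ c → c * c * 0ℤ ≡ 1ℤ * 0ℤ
      base₂ = solve-∀
  lowCoefficients-scale c f (suc n) with lowCoefficients-scale c f n
  ... | e₀ , e₁ , e₂ =
    trans (step₀ c b (c₀ s)) (trans (cong (c * b *_) e₀) (step₀' c b (c ^ n) (c₀ t))) ,
    trans (step c b (c₁ s) (c₀ s)) (trans (cong₂ (λ u v → c * b * u + v) e₁ e₀) (step₁ c b (c ^ n) (c₁ t) (c₀ t))) ,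
    trans (step c b (c₂ s) (c₁ s)) (trans (cong₂ (λ u v → c * b * u + v) e₂ e₁) (step₂ c b (c ^ n) (c₂ t) (c₁ t)))
    where
      s = lowCoefficients (λ j → c * f j) n
      t = lowCoefficients f n
      b = f (suc n)
      step₀ : ∀ c b x → c * c * (c * b * x) ≡ c * b * (c * c * x)
      step₀ = solve-∀
      step₀' : ∀ c b C x → c * b * (C * (c * c * x)) ≡ c * C * (c * c * (b * x))
      step₀' = solve-∀
      step : ∀ c b x y → c * c * (c * b * x + y) ≡ c * b * (c * c * x) + c * c * y
      step = solve-∀
      step₁ : ∀ c b C x y → c * b * (C * (c * x)) + C * (c * c * y) ≡ c * C * (c * (b * x + y))
      step₁ = solve-∀
      step₂ : ∀ c b C x y → c * b * (C * x) + C * (c * y) ≡ c * C * (b * x + y)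
      step₂ = solve-∀

module RisingProduct where

  open import Data.Nat as ℕ using (ℕ; zero; suc; _+_; _*_; _!)
  import Data.Nat.Properties as ℕ
  open import Data.Integer as ℤ using (+_)
  import Data.Integer.Properties as ℤ
  open import Relation.Binary.PropositionalEquality
  open Products

  risingProduct : ℕ → ℕ → ℕ
  risingProduct x zero    = 1
  risingProduct x (suc n) = risingProduct x n * (x + suc n)

  +risingProduct≡∏ : ∀ x n → + risingProduct x n ≡ ∏ n (λ j → + x ℤ.+ + j)
  +risingProduct≡∏ x zero    = refl
  +risingProduct≡∏ x (suc n) = trans (ℤ.pos-* (risingProduct x n) (x + suc n))
    (cong₂ ℤ._*_ (+risingProduct≡∏ x n) (ℤ.pos-+ x (suc n)))

  n!≡risingProduct : ∀ n → n ! ≡ risingProduct 0 n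
  n!≡risingProduct zero    = refl
  n!≡risingProduct (suc n) = trans (ℕ.*-comm (suc n) (n !)) (cong (_* suc n) (n!≡risingProduct n))

  [a+b]!≡a!*risingProduct : ∀ a b → (a + b) ! ≡ a ! * risingProduct a b
  [a+b]!≡a!*risingProduct a zero    = trans (cong _! (ℕ.+-identityʳ a)) (sym (ℕ.*-identityʳ (a !)))
  [a+b]!≡a!*risingProduct a (suc b) = begin
    (a + suc b) !                              ≡⟨ cong _! (ℕ.+-suc a b) ⟩
    suc (a + b) * (a + b) !                    ≡⟨ ℕ.*-comm (suc (a + b)) ((a + b) !) ⟩
    (a + b) ! * suc (a + b)                    ≡⟨ cong (_* suc (a + b)) ([a+b]!≡a!*risingProduct a b) ⟩
    a ! * risingProduct a b * suc (a + b)      ≡⟨ ℕ.*-assoc (a !) (risingProduct a b) (suc (a + b)) ⟩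
    a ! * (risingProduct a b * suc (a + b))    ≡⟨ cong (λ t → a ! * (risingProduct a b * t)) (ℕ.+-suc a b) ⟨
    a ! * risingProduct a (suc b)              ∎
    where open ≡-Reasoning

module HalfProducts (m : ℕ) where

  open import Data.Nat as ℕ using (ℕ; zero; suc; _∸_; _!)
  import Data.Nat.Properties as ℕ
  open import Data.Nat.Tactic.RingSolver using () renaming (solve-∀ to ℕ-solve-∀)
  open import Data.Integer as ℤ using (ℤ; +_; _+_; _*_; -_; _-_; _^_; 1ℤ; 0ℤ; -1ℤ)
  import Data.Integer.Properties as ℤ
  open import Data.Integer.Tactic.RingSolver using (solve-∀)
  open import Relation.Binary.PropositionalEquality
  open Products
  open RisingProduct

  p : ℕ
  p = suc (m ℕ.+ m)

  P : ℤ
  P = + p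

  ε : ℤ
  ε = -1ℤ ^ m

  Q Q₂ : ℤ → ℤ
  Q  y = ∏ m (λ j → y + + j)
  Q₂ y = ∏ m (λ j → y + + 2 * + j)

  Qₚ Q₂ₚ : ℤ → ℤ
  Qₚ  k = Q (k * P)
  Q₂ₚ k = Q₂ (k * P)

  [-1]^n*[-1]^n≡1 : ∀ n → -1ℤ ^ n * -1ℤ ^ n ≡ 1ℤ
  [-1]^n*[-1]^n≡1 zero    = refl
  [-1]^n*[-1]^n≡1 (suc n) = trans (square-neg (-1ℤ ^ n)) ([-1]^n*[-1]^n≡1 n)
    where
      square-neg : ∀ e → (-1ℤ * e) * (-1ℤ * e) ≡ e * e
      square-neg = solve-∀

  ε*ε≡1 : ε * ε ≡ 1ℤ
  ε*ε≡1 = [-1]^n*[-1]^n≡1 m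

  ε*-injective : ∀ {a b} → ε * a ≡ ε * b → a ≡ b
  ε*-injective {a} {b} eq = trans (sym (ε*ε* a)) (trans (cong (ε *_) eq) (ε*ε* b))
    where
      ε*ε* : ∀ a → ε * (ε * a) ≡ a
      ε*ε* a = trans (sym (ℤ.*-assoc ε ε a)) (trans (cong (_* a) ε*ε≡1) (ℤ.*-identityˡ a))

  +a≡+[a+j]-+j : ∀ a j → + a ≡ + (a ℕ.+ j) - + j
  +a≡+[a+j]-+j a j = trans (add-sub (+ a) (+ j)) (cong (_- + j) (sym (ℤ.pos-+ a j)))
    where
      add-sub : ∀ a j → a ≡ (a + j) - j
      add-sub = solve-∀

  Q-upperHalf : ∀ x → ∏ m (λ j → x + + (m ℕ.+ j)) ≡ ε * Q (- x - P)
  Q-upperHalf x = trans (∏-reverse m (λ j → x + + (m ℕ.+ j)))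
                        (trans (∏-cong m reflect) (∏-scale m -1ℤ (λ j → (- x - P) + + j)))
    where
      index : ∀ j → j ℕ.≤ suc m → m ℕ.+ (suc m ∸ j) ℕ.+ j ≡ p
      index j j≤ = trans (ℕ.+-assoc m (suc m ∸ j) j)
                         (trans (cong (m ℕ.+_) (ℕ.m∸n+n≡m j≤)) (ℕ.+-suc m m))
      negate : ∀ x P j → x + (P - j) ≡ -1ℤ * ((- x - P) + j)
      negate = solve-∀
      reflect : ∀ j → 1 ℕ.≤ j → j ℕ.≤ m → x + + (m ℕ.+ (suc m ∸ j)) ≡ -1ℤ * ((- x - P) + + j)
      reflect j _ j≤m = trans (cong (λ t → x + t) (trans (+a≡+[a+j]-+j (m ℕ.+ (suc m ∸ j)) j)
                                                  (cong (λ t → + t - + j) (index j (ℕ.m≤n⇒m≤1+n j≤m)))))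
                              (negate x P (+ j))

  ∏₂ₘ-halves : ∀ x → ∏ (m ℕ.+ m) (λ j → x + + j) ≡ Q x * (ε * Q (- x - P))
  ∏₂ₘ-halves x = trans (∏-+ m m (λ j → x + + j)) (cong (Q x *_) (Q-upperHalf x))

  ∏₂ₘ-parity : ∀ x → ∏ (m ℕ.+ m) (λ j → x + + j)
             ≡ ∏ m (λ i → x + + (i ℕ.+ i ∸ 1)) * ∏ m (λ i → x + + (i ℕ.+ i))
  ∏₂ₘ-parity x = trans (∏-pairs m (λ j → x + + j))
                       (∏-* m (λ i → x + + (i ℕ.+ i ∸ 1)) (λ i → x + + (i ℕ.+ i)))

  Q0≡m! : Q 0ℤ ≡ + (m !)
  Q0≡m! = sym (trans (cong +_ (n!≡risingProduct m)) (+risingProduct≡∏ 0 m))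

  evens-at-0 : ∏ m (λ i → 0ℤ + + (i ℕ.+ i)) ≡ (+ 2) ^ m * Q 0ℤ
  evens-at-0 = trans (∏-cong m double) (∏-scale m (+ 2) (λ j → 0ℤ + + j))
    where
      twice : ∀ a → 0ℤ + (a + a) ≡ + 2 * (0ℤ + a)
      twice = solve-∀
      double : ∀ j → 1 ℕ.≤ j → j ℕ.≤ m → 0ℤ + + (j ℕ.+ j) ≡ + 2 * (0ℤ + + j)
      double j _ _ = trans (cong (λ t → 0ℤ + t) (ℤ.pos-+ j j)) (twice (+ j))

  odds-at-0 : ∏ m (λ i → 0ℤ + + (i ℕ.+ i ∸ 1)) ≡ ε * Q₂ (- P)
  odds-at-0 = trans (∏-reverse m (λ i → 0ℤ + + (i ℕ.+ i ∸ 1)))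
                    (trans (∏-cong m reflect) (∏-scale m -1ℤ (λ j → (- P) + + 2 * + j)))
    where
      index : ∀ i → i ℕ.≤ m → ((suc m ∸ i) ℕ.+ (suc m ∸ i) ∸ 1) ℕ.+ (i ℕ.+ i) ≡ p
      index i i≤m rewrite ℕ.+-∸-assoc 1 i≤m =
        trans (rearrange (m ∸ i) i) (cong (λ z → suc (z ℕ.+ z)) (ℕ.m∸n+n≡m i≤m))
        where
          rearrange : ∀ u i → u ℕ.+ suc u ℕ.+ (i ℕ.+ i) ≡ suc ((u ℕ.+ i) ℕ.+ (u ℕ.+ i))
          rearrange = ℕ-solve-∀
      negate : ∀ P a → 0ℤ + (P - (a + a)) ≡ -1ℤ * ((- P) + + 2 * a)
      negate = solve-∀
      reflect : ∀ j → 1 ℕ.≤ j → j ℕ.≤ m →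
                0ℤ + + ((suc m ∸ j) ℕ.+ (suc m ∸ j) ∸ 1) ≡ -1ℤ * ((- P) + + 2 * + j)
      reflect j _ j≤m =
        trans (cong (λ t → 0ℤ + t) (trans (+a≡+[a+j]-+j _ (j ℕ.+ j)) (cong (λ t → + t - + (j ℕ.+ j)) (index j j≤m))))
              (trans (cong (λ t → 0ℤ + (P - t)) (ℤ.pos-+ j j)) (negate P (+ j)))

  odds-at-p : ∏ m (λ i → P + + (i ℕ.+ i ∸ 1)) ≡ (+ 2) ^ m * (ε * Q (- 0ℤ - P))
  odds-at-p = trans (∏-cong m double)
                    (trans (∏-scale m (+ 2) (λ j → 0ℤ + + (m ℕ.+ j))) (cong ((+ 2) ^ m *_) (Q-upperHalf 0ℤ)))
    where
      twice : ∀ a b → + 1 + (a + a) + (b + (+ 1 + b)) ≡ + 2 * (0ℤ + (a + (+ 1 + b)))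
      twice = solve-∀
      double : ∀ j → 1 ℕ.≤ j → j ℕ.≤ m → P + + (j ℕ.+ j ∸ 1) ≡ + 2 * (0ℤ + + (m ℕ.+ j))
      double (suc i) _ _ =
        trans (cong₂ _+_ (ℤ.pos-+ 1 (m ℕ.+ m)) (ℤ.pos-+ i (suc i)))
        (trans (cong₂ (λ a b → + 1 + a + (+ i + b)) (ℤ.pos-+ m m) (ℤ.pos-+ 1 i))
        (trans (twice (+ m) (+ i))
               (cong (λ t → + 2 * (0ℤ + t)) (sym (trans (ℤ.pos-+ m (suc i)) (cong (λ t → + m + t) (ℤ.pos-+ 1 i)))))))

  evens-at-p : ∏ m (λ i → P + + (i ℕ.+ i)) ≡ Q₂ (1ℤ * P)
  evens-at-p = ∏-cong m shift
    where
      twice : ∀ P a → P + (a + a) ≡ 1ℤ * P + + 2 * a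
      twice = solve-∀
      shift : ∀ j → 1 ℕ.≤ j → j ℕ.≤ m → P + + (j ℕ.+ j) ≡ 1ℤ * P + + 2 * + j
      shift j _ _ = trans (cong (λ t → P + t) (ℤ.pos-+ j j)) (twice P (+ j))

  Qₚ[-1]≡2^m*Q₂ₚ[-1] : Qₚ -1ℤ ≡ (+ 2) ^ m * Q₂ₚ -1ℤ
  Qₚ[-1]≡2^m*Q₂ₚ[-1] = ε*-injective (ℤ.*-cancelˡ-≡ (Q 0ℤ) _ _ {{Q0≢0}} (begin
    Q 0ℤ * (ε * Q (-1ℤ * P))             ≡⟨ cong (λ y → Q 0ℤ * (ε * Q y)) (-1*P≡-0-P P) ⟩
    Q 0ℤ * (ε * Q (- 0ℤ - P))            ≡⟨ ∏₂ₘ-halves 0ℤ ⟨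
    ∏ (m ℕ.+ m) (λ j → 0ℤ + + j)         ≡⟨ ∏₂ₘ-parity 0ℤ ⟩
    _                                    ≡⟨ cong₂ _*_ odds-at-0 evens-at-0 ⟩
    ε * Q₂ (- P) * ((+ 2) ^ m * Q 0ℤ)    ≡⟨ rearrange ε (Q₂ (- P)) ((+ 2) ^ m) (Q 0ℤ) ⟩
    Q 0ℤ * (ε * ((+ 2) ^ m * Q₂ (- P)))  ≡⟨ cong (λ y → Q 0ℤ * (ε * ((+ 2) ^ m * Q₂ y))) (-P≡-1*P P) ⟩
    Q 0ℤ * (ε * ((+ 2) ^ m * Q₂ (-1ℤ * P))) ∎))
    where
      open ≡-Reasoning
      Q0≢0 : ℤ.NonZero (Q 0ℤ)
      Q0≢0 = subst ℤ.NonZero (sym Q0≡m!) (m ℕ.!≢0)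
      -1*P≡-0-P : ∀ P → -1ℤ * P ≡ - 0ℤ - P
      -1*P≡-0-P = solve-∀
      -P≡-1*P : ∀ P → - P ≡ -1ℤ * P
      -P≡-1*P = solve-∀
      rearrange : ∀ e q t a → e * q * (t * a) ≡ a * (e * (t * q))
      rearrange = solve-∀

  Qₚ[1]*Qₚ[-2]≡2^m*Qₚ[-1]*Q₂ₚ[1] : Qₚ 1ℤ * Qₚ (- + 2) ≡ (+ 2) ^ m * Qₚ -1ℤ * Q₂ₚ 1ℤ
  Qₚ[1]*Qₚ[-2]≡2^m*Qₚ[-1]*Q₂ₚ[1] = ε*-injective (begin
    ε * (Q (1ℤ * P) * Q ((- + 2) * P))         ≡⟨ cong₂ (λ y z → ε * (Q y * Q z)) (ℤ.*-identityˡ P) (-2P≡-P-P P) ⟩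
    ε * (Q P * Q (- P - P))                    ≡⟨ swap ε (Q P) (Q (- P - P)) ⟩
    Q P * (ε * Q (- P - P))                    ≡⟨ ∏₂ₘ-halves P ⟨
    ∏ (m ℕ.+ m) (λ j → P + + j)                ≡⟨ ∏₂ₘ-parity P ⟩
    _                                          ≡⟨ cong₂ _*_ odds-at-p evens-at-p ⟩
    (+ 2) ^ m * (ε * Q (- 0ℤ - P)) * Q₂ (1ℤ * P)
                                               ≡⟨ rearrange ε ((+ 2) ^ m) (Q (- 0ℤ - P)) (Q₂ (1ℤ * P)) ⟩
    ε * ((+ 2) ^ m * Q (- 0ℤ - P) * Q₂ (1ℤ * P))
                                               ≡⟨ cong (λ y → ε * ((+ 2) ^ m * Q y * Q₂ (1ℤ * P))) (-0-P≡-1*P P) ⟩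
    ε * ((+ 2) ^ m * Q (-1ℤ * P) * Q₂ (1ℤ * P)) ∎)
    where
      open ≡-Reasoning
      -2P≡-P-P : ∀ P → (- + 2) * P ≡ - P - P
      -2P≡-P-P = solve-∀
      swap : ∀ e a b → e * (a * b) ≡ a * (e * b)
      swap = solve-∀
      rearrange : ∀ e t a b → t * (e * a) * b ≡ e * (t * a * b)
      rearrange = solve-∀
      -0-P≡-1*P : ∀ P → - 0ℤ - P ≡ -1ℤ * P
      -0-P≡-1*P = solve-∀

module Binomials (m : ℕ) where

  open import Data.Nat using (suc; _+_; _*_; _∸_; _^_; _!; NonZero)
  import Data.Nat.Properties as ℕ
  open import Data.Nat.Combinatorics using (_C_; k![n∸k]!∣n!)
  open import Data.Nat.Combinatorics.Specification using (nCk≡n!/k![n-k]!)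
  open import Data.Nat.DivMod using (_/_; m/n*n≡m)
  open import Data.Nat.Tactic.RingSolver using (solve-∀)
  open import Relation.Binary.PropositionalEquality
  open import Defs using (Gnum; Gden)
  open RisingProduct

  C*k!*l!≡n! : ∀ {n} k l → k + l ≡ n → (n C k) * (k ! * l !) ≡ n !
  C*k!*l!≡n! k l refl = begin
    ((k + l) C k) * (k ! * l !)              ≡⟨ cong (λ i → ((k + l) C k) * (k ! * i !)) (ℕ.m+n∸m≡n k l) ⟨
    ((k + l) C k) * (k ! * (k + l ∸ k) !)    ≡⟨ cong (_* (k ! * (k + l ∸ k) !)) (nCk≡n!/k![n-k]! k≤k+l) ⟩
    ((k + l) ! / (k ! * (k + l ∸ k) !)) * (k ! * (k + l ∸ k) !)
                                             ≡⟨ m/n*n≡m (k![n∸k]!∣n! k≤k+l) ⟩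
    (k + l) !                                ∎
    where
      open ≡-Reasoning
      k≤k+l = ℕ.m≤m+n k l
      instance _ = k ℕ.!* (k + l ∸ k) !≢0

  p k : ℕ
  p = suc (m + m)
  k = suc m

  F₀ F₁ F₂ Q₁ W : ℕ
  F₀ = risingProduct 0 (m + m)
  F₁ = risingProduct p (m + m)
  F₂ = risingProduct (p + p) (m + m)
  Q₁ = risingProduct p m
  W  = 2 ^ (m + m)

  W⁷ Z F : ℕ
  W⁷ = W * W * W * W * W * W * W
  Z  = W⁷ * F₀ * F₀ * Q₁ * m !
  F  = F₁ * F₁ * F₂

  p!≡p*F₀ : p ! ≡ p * F₀
  p!≡p*F₀ = cong (p *_) (n!≡risingProduct (m + m))

  [p+n]! : ∀ n → (p + n) ! ≡ p * F₀ * risingProduct p n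
  [p+n]! n = trans ([a+b]!≡a!*risingProduct p n) (cong (_* risingProduct p n) p!≡p*F₀)

  [2p+1+p]! : ((p + p) + suc p) ! ≡ p * F₀ * (F₁ * (p + p)) * (F₂ * (p + p + p) * (p + p + suc p))
  [2p+1+p]! = trans ([a+b]!≡a!*risingProduct (p + p) (suc p)) (cong (_* risingProduct (p + p) (suc p)) ([p+n]! p))

  C[2p,p] : ((2 * p) C p) * (p ! * p !) ≡ p * F₀ * (F₁ * (p + p))
  C[2p,p] = trans (C*k!*l!≡n! p p (sym (2*n≡n+n p))) (trans (cong _! (2*n≡n+n p)) ([p+n]! p))
    where
      2*n≡n+n : ∀ n → 2 * n ≡ n + n
      2*n≡n+n = solve-∀

  C[2p+2k,p+k] : ((2 * p + 2 * k) C (p + k)) * ((p + k) ! * (p + k) !)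
               ≡ p * F₀ * (F₁ * (p + p)) * (F₂ * (p + p + p) * (p + p + suc p))
  C[2p+2k,p+k] = trans (C*k!*l!≡n! (p + k) (p + k) (sym (halves m))) (trans (cong _! (regroup m)) [2p+1+p]!)
    where
      halves : ∀ m → 2 * suc (m + m) + 2 * suc m ≡ (suc (m + m) + suc m) + (suc (m + m) + suc m)
      halves = solve-∀
      regroup : ∀ m → 2 * suc (m + m) + 2 * suc m ≡ (suc (m + m) + suc (m + m)) + suc (suc (m + m))
      regroup = solve-∀

  C[2p-2k,p-k] : ((2 * p ∸ 2 * k) C (p ∸ k)) * (m ! * m !) ≡ F₀
  C[2p-2k,p-k] = trans (cong₂ (λ a b → (a C b) * (m ! * m !)) 2p-2k≡2m p-k≡m)
                       (trans (C*k!*l!≡n! m m refl) (n!≡risingProduct (m + m)))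
    where
      split₂ : ∀ m → 2 * suc (m + m) ≡ (m + m) + 2 * suc m
      split₂ = solve-∀
      split₁ : ∀ m → suc (m + m) ≡ m + suc m
      split₁ = solve-∀
      2p-2k≡2m : 2 * p ∸ 2 * k ≡ m + m
      2p-2k≡2m = trans (cong (_∸ 2 * k) (split₂ m)) (ℕ.m+n∸n≡m (m + m) (2 * k))
      p-k≡m : p ∸ k ≡ m
      p-k≡m = trans (cong (_∸ k) (split₁ m)) (ℕ.m+n∸n≡m m k)

  C[p+k,p] : ((p + k) C p) * (p ! * k !) ≡ p * F₀ * (Q₁ * (p + k))
  C[p+k,p] = trans (C*k!*l!≡n! p k refl) ([p+n]! k)

  C[2k,k] : ((2 * k) C k) * (k ! * k !) ≡ suc p * (p * F₀)
  C[2k,k] = trans (C*k!*l!≡n! k k (sym (2*n≡n+n k))) (trans (cong _! (2k≡p+1 m)) (cong (suc p *_) p!≡p*F₀))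
    where
      2*n≡n+n : ∀ n → 2 * n ≡ n + n
      2*n≡n+n = solve-∀
      2k≡p+1 : ∀ m → 2 * suc m ≡ suc (suc (m + m))
      2k≡p+1 = solve-∀

  8p-2k-4≡2+14m : 8 * p ∸ 2 * k ∸ 4 ≡ 2 + 7 * (m + m)
  8p-2k-4≡2+14m = trans (cong (λ n → n ∸ 2 * k ∸ 4) (split m))
    (trans (cong (_∸ 4) (ℕ.m+n∸n≡m (2 + 7 * (m + m) + 4) (2 * k))) (ℕ.m+n∸n≡m (2 + 7 * (m + m)) 4))
    where
      split : ∀ m → 8 * suc (m + m) ≡ (2 + 7 * (m + m) + 4) + 2 * suc m
      split = solve-∀

  2^[8p-2k-4]≡4*W⁷ : 2 ^ (8 * p ∸ 2 * k ∸ 4) ≡ 4 * W⁷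
  2^[8p-2k-4]≡4*W⁷ = begin
    2 ^ (8 * p ∸ 2 * k ∸ 4)       ≡⟨ cong (2 ^_) 8p-2k-4≡2+14m ⟩
    2 ^ (2 + 7 * (m + m))         ≡⟨ ℕ.^-distribˡ-+-* 2 2 (7 * (m + m)) ⟩
    4 * 2 ^ (7 * (m + m))         ≡⟨ cong (λ n → 4 * 2 ^ n) (ℕ.*-comm 7 (m + m)) ⟩
    4 * 2 ^ ((m + m) * 7)         ≡⟨ cong (4 *_) (ℕ.^-*-assoc 2 (m + m) 7) ⟨
    4 * W ^ 7                     ≡⟨ cong (4 *_) (seventh W) ⟩
    4 * W⁷                        ∎
    where
      open ≡-Reasoning
      seventh : ∀ w → w * (w * (w * (w * (w * (w * (w * 1)))))) ≡ w * w * w * w * w * w * w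
      seventh = solve-∀

  2p+2k-1≡3p : 2 * p + 2 * k ∸ 1 ≡ p + p + p
  2p+2k-1≡3p = cong (_∸ 1) (split m)
    where
      split : ∀ m → 2 * suc (m + m) + 2 * suc m ≡ suc (suc (m + m) + suc (m + m) + suc (m + m))
      split = solve-∀

  -- The factorials left in the denominators after writing the binomials of Gnum, resp. Gden, via n!.
  K-num K-den : ℕ
  K-num = (p ! * p !) * ((p + k) ! * (p + k) !) * (m ! * m !) * (p ! * k !)
  K-den = k ! * k !

  Gnum*K-num : Gnum p k * K-num
             ≡ p * (p * 1) * (p * F₀ * (F₁ * (p + p))) * (p * F₀ * (F₁ * (p + p)) * (F₂ * (p + p + p) * (p + p + suc p)))
               * F₀ * (p * F₀ * (Q₁ * (p + k)))
  Gnum*K-num = begin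
    p * (p * 1) * c₁ * c₂ * c₃ * c₄ * K-num
      ≡⟨ regroup (p * (p * 1)) c₁ c₂ c₃ c₄ (p ! * p !) ((p + k) ! * (p + k) !) (m ! * m !) (p ! * k !) ⟩
    p * (p * 1) * (c₁ * (p ! * p !)) * (c₂ * ((p + k) ! * (p + k) !)) * (c₃ * (m ! * m !)) * (c₄ * (p ! * k !))
      ≡⟨ cong₂ (λ x y → p * (p * 1) * x * y * (c₃ * (m ! * m !)) * (c₄ * (p ! * k !))) C[2p,p] C[2p+2k,p+k] ⟩
    _ ≡⟨ cong₂ (λ x y → p * (p * 1) * (p * F₀ * (F₁ * (p + p)))
                         * (p * F₀ * (F₁ * (p + p)) * (F₂ * (p + p + p) * (p + p + suc p))) * x * y)
               C[2p-2k,p-k] C[p+k,p] ⟩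
    _ ∎
    where
      open ≡-Reasoning
      c₁ = (2 * p) C p
      c₂ = (2 * p + 2 * k) C (p + k)
      c₃ = (2 * p ∸ 2 * k) C (p ∸ k)
      c₄ = (p + k) C p
      regroup : ∀ a c₁ c₂ c₃ c₄ d₁ d₂ d₃ d₄ → a * c₁ * c₂ * c₃ * c₄ * (d₁ * d₂ * d₃ * d₄)
              ≡ a * (c₁ * d₁) * (c₂ * d₂) * (c₃ * d₃) * (c₄ * d₄)
      regroup = solve-∀

  Gden*K-den : Gden p k * K-den ≡ 4 * W⁷ * (p + p + p) * (suc p * (p * F₀))
  Gden*K-den = trans (ℕ.*-assoc (2 ^ (8 * p ∸ 2 * k ∸ 4) * (2 * p + 2 * k ∸ 1)) ((2 * k) C k) K-den)
                     (cong₂ _*_ (cong₂ _*_ 2^[8p-2k-4]≡4*W⁷ 2p+2k-1≡3p) C[2k,k])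

  K-num≡ : K-num ≡ (p * F₀ * (p * F₀)) * ((p * F₀ * (Q₁ * (p + k))) * (p * F₀ * (Q₁ * (p + k))))
                   * (m ! * m !) * (p * F₀ * (k * m !))
  K-num≡ = cong₂ (λ a b → (a * a) * (b * b) * (m ! * m !) * (a * (k * m !))) p!≡p*F₀ ([p+n]! k)

  K-num*K-den≢0 : NonZero (K-num * K-den)
  K-num*K-den≢0 = ℕ.m*n≢0 K-num K-den
    {{ℕ.m*n≢0 _ _ {{ℕ.m*n≢0 _ _ {{ℕ.m*n≢0 _ _ {{p ℕ.!* p !≢0}} {{(p + k) ℕ.!* (p + k) !≢0}}}}
                                 {{m ℕ.!* m !≢0}}}} {{p ℕ.!* k !≢0}}}}
    {{k ℕ.!* k !≢0}}

  Gnum*Z≡Gden*p*F : Gnum p k * Z ≡ Gden p k * (p * F)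
  Gnum*Z≡Gden*p*F = ℕ.*-cancelʳ-≡ (Gnum p k * Z) (Gden p k * (p * F)) (K-num * K-den) {{K-num*K-den≢0}} (begin
    Gnum p k * Z * (K-num * K-den)            ≡⟨ regroup₁ (Gnum p k) Z K-num K-den ⟩
    Gnum p k * K-num * Z * K-den              ≡⟨ cong (λ x → x * Z * K-den) Gnum*K-num ⟩
    _                                         ≡⟨ cleared m F₀ F₁ F₂ Q₁ (m !) W⁷ ⟩
    _                                         ≡⟨ cong₂ (λ x y → x * (p * F) * y) Gden*K-den K-num≡ ⟨
    Gden p k * K-den * (p * F) * K-num        ≡⟨ regroup₂ (Gden p k) K-den (p * F) K-num ⟩
    Gden p k * (p * F) * (K-num * K-den)      ∎)
    where
      open ≡-Reasoning
      cleared : ∀ m F₀ F₁ F₂ Q₁ a W⁷ → let p = suc (m + m) ; k = suc m in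
        (p * (p * 1) * (p * F₀ * (F₁ * (p + p))) * (p * F₀ * (F₁ * (p + p)) * (F₂ * (p + p + p) * (p + p + suc p)))
          * F₀ * (p * F₀ * (Q₁ * (p + k)))) * (W⁷ * F₀ * F₀ * Q₁ * a) * ((k * a) * (k * a))
        ≡ (4 * W⁷ * (p + p + p) * (suc p * (p * F₀))) * (p * (F₁ * F₁ * F₂))
          * ((p * F₀ * (p * F₀)) * ((p * F₀ * (Q₁ * (p + k))) * (p * F₀ * (Q₁ * (p + k)))) * (a * a) * (p * F₀ * (k * a)))
      cleared = solve-∀
      regroup₁ : ∀ g z a b → g * z * (a * b) ≡ (g * a) * z * b
      regroup₁ = solve-∀
      regroup₂ : ∀ g d x a → (g * d) * x * a ≡ g * x * (a * d)
      regroup₂ = solve-∀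

module ModuloP³ (m : ℕ) (p-prime : Prime (HalfProducts.p m)) (3<p : 3 < HalfProducts.p m) where

  open import Data.Nat as ℕ using (zero; suc; _<_; _!; z≤n; s≤s)
  import Data.Nat.Properties as ℕ
  open import Data.Nat.Divisibility as ℕ using (_∤_)
  open import Data.Integer as ℤ using (ℤ; +_; _+_; _*_; -_; _-_; _^_; ∣_∣; 1ℤ; 0ℤ; -1ℤ)
  import Data.Integer.Properties as ℤ
  open import Data.Integer.Tactic.RingSolver using (solve-∀)
  open import Data.Product using (_,_)
  open import Relation.Binary.PropositionalEquality
  open Congruence
  open Products
  open RisingProduct
  open HalfProducts m
  open Binomials m using (F₀; F₁; F₂; Q₁; W; W⁷; Z; F)
  open PrimeModulus p-prime

  P³ : ℤ
  P³ = P * P * P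

  infix 4 _≡₁_ _≡₃_
  _≡₁_ _≡₃_ : ℤ → ℤ → Set
  x ≡₁ y = x ≡ y [mod P ]
  x ≡₃ y = x ≡ y [mod P³ ]

  ≡₃⇒≡₁ : ∀ {x y} → x ≡₃ y → x ≡₁ y
  ≡₃⇒≡₁ = mod-weaken {P * P}

  cancel₁ : ∀ {a x y} → p ∤ ∣ a ∣ → a * x ≡₁ a * y → x ≡₁ y
  cancel₁ {a} {x} {y} p∤a = subst (λ n → a * x ≡ a * y [mod n ] → x ≡ y [mod n ]) +p¹≡P (mod-p^-cancelˡ 1 {a} {x} {y} p∤a)
    where
      +p¹≡P : + (p ℕ.^ 1) ≡ P
      +p¹≡P = cong +_ (ℕ.*-identityʳ p)

  cancel₃ : ∀ {a x y} → p ∤ ∣ a ∣ → a * x ≡₃ a * y → x ≡₃ y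
  cancel₃ {a} {x} {y} p∤a = subst (λ n → a * x ≡ a * y [mod n ] → x ≡ y [mod n ]) +p³≡P³ (mod-p^-cancelˡ 3 {a} {x} {y} p∤a)
    where
      +p³≡P³ : + (p ℕ.^ 3) ≡ P³
      +p³≡P³ = trans (ℤ.pos-* p (p ℕ.^ 2)) (trans (cong (P *_) (trans (ℤ.pos-* p (p ℕ.^ 1))
                 (cong (P *_) (trans (ℤ.pos-* p 1) (ℤ.*-identityʳ P))))) (sym (ℤ.*-assoc P P P)))

  p∤2 : p ∤ 2
  p∤2 = ∤-small (s≤s z≤n) (ℕ.<-trans (s≤s (s≤s (s≤s z≤n))) 3<p)

  p∤3 : p ∤ 3
  p∤3 = ∤-small (s≤s z≤n) 3<p

  ∤-risingProduct : ∀ {x} n → p ℕ.∣ x → n < p → p ∤ risingProduct x n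
  ∤-risingProduct zero    _   _   = ∤1
  ∤-risingProduct (suc n) p∣x n<p = ∤-* (∤-risingProduct n p∣x (ℕ.<-trans (ℕ.n<1+n n) n<p))
    (λ p∣x+n → ∤-small (s≤s z≤n) n<p (ℕ.∣m+n∣m⇒∣n p∣x+n p∣x))

  m<p : m < p
  m<p = s≤s (ℕ.m≤m+n m m)

  p∤m! : p ∤ m !
  p∤m! = subst (p ∤_) (sym (n!≡risingProduct m)) (∤-risingProduct m (ℕ._∣0 p) m<p)

  coefficients : Quadratic
  coefficients = lowCoefficients (λ j → + j) m

  A B C : ℤ
  A = c₀ coefficients
  B = c₁ coefficients * P
  C = c₂ coefficients * P * P

  open QuadraticForm A B C

  A≡m! : A ≡ + (m !)
  A≡m! = trans (c₀-lowCoefficients (λ j → + j) m) Q0≡m!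

  p∤A : p ∤ ∣ A ∣
  p∤A = subst (λ a → p ∤ ∣ a ∣) (sym A≡m!) p∤m!

  Qₚ≡E : ∀ k → Qₚ k ≡₃ E k
  Qₚ≡E k with ∏-lowCoefficients (λ j → + j) m (k * P)
  ... | r , eq = by-multiple (k * k * k * r) (trans eq (collect (c₀ coefficients) (c₁ coefficients) (c₂ coefficients) k P r))
    where
      collect : ∀ a b c k P r → (a + b * (k * P) + c * (k * P * (k * P))) + k * P * (k * P) * (k * P) * r
              ≡ (a + k * (b * P) + k * k * (c * P * P)) + k * k * k * r * (P * P * P)
      collect = solve-∀

  4Q₂ₚ≡2^m*E½ : ∀ k → + 4 * Q₂ₚ k ≡₃ (+ 2) ^ m * E½ k
  4Q₂ₚ≡2^m*E½ k with ∏-lowCoefficients (λ j → + 2 * + j) m (k * P) | lowCoefficients-scale (+ 2) (λ j → + j) m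
  ... | r , eq | e₀ , e₁ , e₂ = by-multiple (+ 4 * k * k * k * r) (begin
    + 4 * Q₂ₚ k                                              ≡⟨ cong (+ 4 *_) eq ⟩
    + 4 * (evalQuadratic s y + y * y * y * r)                ≡⟨ distribute (c₀ s) (c₁ s) (c₂ s) y r ⟩
    + 2 * + 2 * c₀ s + + 2 * + 2 * c₁ s * y + + 2 * + 2 * c₂ s * (y * y) + + 4 * (y * y * y * r)
                                                             ≡⟨ cong₂ (λ u v → u + v * y + + 2 * + 2 * c₂ s * (y * y) + + 4 * (y * y * y * r)) e₀ e₁ ⟩
    _                                                        ≡⟨ cong (λ w → (+ 2) ^ m * (+ 2 * + 2 * c₀ t) + (+ 2) ^ m * (+ 2 * c₁ t) * y + w * (y * y) + + 4 * (y * y * y * r)) e₂ ⟩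
    (+ 2) ^ m * (+ 2 * + 2 * c₀ t) + (+ 2) ^ m * (+ 2 * c₁ t) * y + (+ 2) ^ m * c₂ t * (y * y) + + 4 * (y * y * y * r)
                                                             ≡⟨ collect ((+ 2) ^ m) (c₀ t) (c₁ t) (c₂ t) k P r ⟩
    (+ 2) ^ m * E½ k + + 4 * k * k * k * r * P³              ∎)
    where
      open ≡-Reasoning
      s = lowCoefficients (λ j → + 2 * + j) m
      t = coefficients
      y = k * P
      distribute : ∀ a b c y r → + 4 * ((a + b * y + c * (y * y)) + y * y * y * r)
                 ≡ + 2 * + 2 * a + + 2 * + 2 * b * y + + 2 * + 2 * c * (y * y) + + 4 * (y * y * y * r)
      distribute = solve-∀
      collect : ∀ M a b c k P r → M * (+ 2 * + 2 * a) + M * (+ 2 * b) * (k * P) + M * c * ((k * P) * (k * P)) + + 4 * ((k * P) * (k * P) * (k * P) * r)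
              ≡ M * (+ 4 * a + + 2 * k * (b * P) + k * k * (c * P * P)) + + 4 * k * k * k * r * (P * P * P)
      collect = solve-∀

  T : ℤ
  T = (+ 2) ^ m * (+ 2) ^ m

  4E[-1]≡T*E½[-1] : + 4 * E -1ℤ ≡₃ T * E½ -1ℤ
  4E[-1]≡T*E½[-1] = begin
    + 4 * E -1ℤ                      ≈⟨ mod-*ˡ (+ 4) (mod-sym (Qₚ≡E -1ℤ)) ⟩
    + 4 * Qₚ -1ℤ                     ≡⟨ cong (+ 4 *_) Qₚ[-1]≡2^m*Q₂ₚ[-1] ⟩
    + 4 * ((+ 2) ^ m * Q₂ₚ -1ℤ)      ≡⟨ swap (+ 4) ((+ 2) ^ m) (Q₂ₚ -1ℤ) ⟩
    (+ 2) ^ m * (+ 4 * Q₂ₚ -1ℤ)      ≈⟨ mod-*ˡ ((+ 2) ^ m) (4Q₂ₚ≡2^m*E½ -1ℤ) ⟩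
    (+ 2) ^ m * ((+ 2) ^ m * E½ -1ℤ) ≡⟨ ℤ.*-assoc ((+ 2) ^ m) ((+ 2) ^ m) (E½ -1ℤ) ⟨
    T * E½ -1ℤ                       ∎
    where
      open mod-Reasoning
      swap : ∀ a b c → a * (b * c) ≡ b * (a * c)
      swap = solve-∀

  4E[1]E[-2]≡T*E[-1]*E½[1] : + 4 * (E 1ℤ * E (- + 2)) ≡₃ T * (E -1ℤ * E½ 1ℤ)
  4E[1]E[-2]≡T*E[-1]*E½[1] = begin
    + 4 * (E 1ℤ * E (- + 2))                      ≈⟨ mod-*ˡ (+ 4) (mod-* (mod-sym (Qₚ≡E 1ℤ)) (mod-sym (Qₚ≡E (- + 2)))) ⟩
    + 4 * (Qₚ 1ℤ * Qₚ (- + 2))                    ≡⟨ cong (+ 4 *_) Qₚ[1]*Qₚ[-2]≡2^m*Qₚ[-1]*Q₂ₚ[1] ⟩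
    + 4 * ((+ 2) ^ m * Qₚ -1ℤ * Q₂ₚ 1ℤ)           ≡⟨ swap (+ 4) ((+ 2) ^ m) (Qₚ -1ℤ) (Q₂ₚ 1ℤ) ⟩
    (+ 2) ^ m * Qₚ -1ℤ * (+ 4 * Q₂ₚ 1ℤ)           ≈⟨ mod-* (mod-*ˡ ((+ 2) ^ m) (Qₚ≡E -1ℤ)) (4Q₂ₚ≡2^m*E½ 1ℤ) ⟩
    (+ 2) ^ m * E -1ℤ * ((+ 2) ^ m * E½ 1ℤ)       ≡⟨ regroup ((+ 2) ^ m) (E -1ℤ) (E½ 1ℤ) ⟩
    T * (E -1ℤ * E½ 1ℤ)                           ∎
    where
      open mod-Reasoning
      swap : ∀ a b c d → a * (b * c * d) ≡ b * c * (a * d)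
      swap = solve-∀
      regroup : ∀ M e h → M * e * (M * h) ≡ M * M * (e * h)
      regroup = solve-∀

  E≡₁A : ∀ k → E k ≡₁ A
  E≡₁A k = by-multiple (k * c₁ coefficients + k * k * c₂ coefficients * P) (collect A (c₁ coefficients) (c₂ coefficients) k P)
    where
      collect : ∀ A b c k P → A + k * (b * P) + k * k * (c * P * P) ≡ A + (k * b + k * k * c * P) * P
      collect = solve-∀

  E½≡₁4A : ∀ k → E½ k ≡₁ + 4 * A
  E½≡₁4A k = by-multiple (+ 2 * k * c₁ coefficients + k * k * c₂ coefficients * P) (collect A (c₁ coefficients) (c₂ coefficients) k P)
    where
      collect : ∀ A b c k P → + 4 * A + + 2 * k * (b * P) + k * k * (c * P * P) ≡ + 4 * A + (+ 2 * k * b + k * k * c * P) * P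
      collect = solve-∀

  p∤4A : p ∤ ∣ + 4 * A ∣
  p∤4A = ∤-∣*∣ {+ 4} {A} (∤-* p∤2 p∤2) p∤A

  T≡₁1 : T ≡₁ 1ℤ
  T≡₁1 = mod-sym (cancel₁ {+ 4 * A} {1ℤ} {T} p∤4A (begin
    + 4 * A * 1ℤ     ≡⟨ ℤ.*-identityʳ (+ 4 * A) ⟩
    + 4 * A          ≈⟨ mod-sym (mod-*ˡ (+ 4) (E≡₁A -1ℤ)) ⟩
    + 4 * E -1ℤ      ≈⟨ ≡₃⇒≡₁ 4E[-1]≡T*E½[-1] ⟩
    T * E½ -1ℤ       ≈⟨ mod-*ˡ T (E½≡₁4A -1ℤ) ⟩
    T * (+ 4 * A)    ≡⟨ ℤ.*-comm T (+ 4 * A) ⟩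
    + 4 * A * T      ∎))
    where open mod-Reasoning

  p∤8-2T : p ∤ ∣ + 8 - + 2 * T ∣
  p∤8-2T = ∤-mod {+ 8 - + 2 * T} {+ 6} (begin
    + 8 - + 2 * T         ≡⟨ minus (+ 8) (+ 2) T ⟩
    + 8 + - + 2 * T       ≈⟨ mod-+ (mod-refl {x = + 8}) (mod-*ˡ (- + 2) T≡₁1) ⟩
    + 8 + - + 2 * 1ℤ      ∎) (∤-∣*∣ {+ 2} {+ 3} p∤2 p∤3)
    where
      open mod-Reasoning
      minus : ∀ a b c → a - b * c ≡ a + - b * c
      minus = solve-∀

  -- Eliminating the two product relations shows (8 - 2T)(2AC - B²) ≡ 0, and 8 - 2T ≡ 6 is a unit.
  discriminant≡0 : + 2 * A * C - B * B ≡₃ 0ℤ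
  discriminant≡0 = cancel₃ {+ 8 - + 2 * T} {+ 2 * A * C - B * B} {0ℤ} p∤8-2T (begin
    (+ 8 - + 2 * T) * (+ 2 * A * C - B * B)
      ≡⟨ identity A (c₁ coefficients) (c₂ coefficients) P T ⟩
    (+ 4 * (E 1ℤ * E (- + 2)) - T * (E -1ℤ * E½ 1ℤ)) + (- A) * (+ 4 * E -1ℤ - T * E½ -1ℤ) + (- w) * P³
      ≈⟨ mod-+ (mod-+ (mod-difference 4E[1]E[-2]≡T*E[-1]*E½[1]) (mod-*ˡ (- A) (mod-difference 4E[-1]≡T*E½[-1]))) (multiple≡0 (- w)) ⟩
    0ℤ + (- A) * 0ℤ + 0ℤ
      ≡⟨ vanish A (+ 8 - + 2 * T) ⟩
    (+ 8 - + 2 * T) * 0ℤ ∎)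
    where
      open mod-Reasoning
      w = (+ 8 - T) * (c₁ coefficients * c₂ coefficients) + (+ 16 - T) * (c₂ coefficients * c₂ coefficients * P)
      identity : ∀ A b c P T → let B = b * P ; C = c * P * P ; E = λ k → A + k * B + k * k * C
                                   E½ = λ k → + 4 * A + + 2 * k * B + k * k * C in
        (+ 8 - + 2 * T) * (+ 2 * A * C - B * B)
        ≡ (+ 4 * (E 1ℤ * E (- + 2)) - T * (E -1ℤ * E½ 1ℤ)) + (- A) * (+ 4 * E -1ℤ - T * E½ -1ℤ)
          + (- ((+ 8 - T) * (b * c) + (+ 16 - T) * (c * c * P))) * (P * P * P)
      identity = solve-∀
      vanish : ∀ A x → 0ℤ + (- A) * 0ℤ + 0ℤ ≡ x * 0ℤ
      vanish = solve-∀

  BC≡0 : B * C ≡₃ 0ℤ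
  BC≡0 = by-multiple (c₁ coefficients * c₂ coefficients) (collect (c₁ coefficients) (c₂ coefficients) P)
    where
      collect : ∀ b c P → b * P * (c * P * P) ≡ 0ℤ + b * c * (P * P * P)
      collect = solve-∀

  CC≡0 : C * C ≡₃ 0ℤ
  CC≡0 = by-multiple (c₂ coefficients * c₂ coefficients * P) (collect (c₂ coefficients) P)
    where
      collect : ∀ c P → c * P * P * (c * P * P) ≡ 0ℤ + c * c * P * (P * P * P)
      collect = solve-∀

  E-mul : ∀ k l → E k * E l ≡₃ A * E (k + l)
  E-mul = E-multiplicative discriminant≡0 BC≡0 CC≡0

  E½-sq : ∀ k → E½ k * E½ k ≡₃ + 16 * A * E k
  E½-sq = E½-square discriminant≡0 BC≡0 CC≡0

  E0≡A : E 0ℤ ≡ A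
  E0≡A = vanish A B C
    where
      vanish : ∀ A B C → A + 0ℤ * B + 0ℤ * 0ℤ * C ≡ A
      vanish = solve-∀

  E[-1]≡T²A : E -1ℤ ≡₃ T * T * A
  E[-1]≡T²A = cancel₃ {+ 16 * E -1ℤ} {E -1ℤ} {T * T * A} p∤16E[-1] (begin
    + 16 * E -1ℤ * E -1ℤ               ≡⟨ square (E -1ℤ) ⟩
    (+ 4 * E -1ℤ) * (+ 4 * E -1ℤ)      ≈⟨ mod-* 4E[-1]≡T*E½[-1] 4E[-1]≡T*E½[-1] ⟩
    (T * E½ -1ℤ) * (T * E½ -1ℤ)        ≡⟨ interchange T (E½ -1ℤ) ⟩
    T * T * (E½ -1ℤ * E½ -1ℤ)          ≈⟨ mod-*ˡ (T * T) (E½-sq -1ℤ) ⟩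
    T * T * (+ 16 * A * E -1ℤ)         ≡⟨ regroup T A (E -1ℤ) ⟩
    + 16 * E -1ℤ * (T * T * A)         ∎)
    where
      open mod-Reasoning
      p∤16E[-1] : p ∤ ∣ + 16 * E -1ℤ ∣
      p∤16E[-1] = ∤-∣*∣ {+ 16} {E -1ℤ} (∤-* (∤-* p∤2 p∤2) (∤-* p∤2 p∤2)) (∤-mod (E≡₁A -1ℤ) p∤A)
      square : ∀ e → + 16 * e * e ≡ (+ 4 * e) * (+ 4 * e)
      square = solve-∀
      interchange : ∀ t h → (t * h) * (t * h) ≡ t * t * (h * h)
      interchange = solve-∀
      regroup : ∀ t a e → t * t * (+ 16 * a * e) ≡ + 16 * e * (t * t * a)
      regroup = solve-∀

  Qₚ[-1]≡T²A : Qₚ -1ℤ ≡₃ T * T * A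
  Qₚ[-1]≡T²A = mod-trans (Qₚ≡E -1ℤ) E[-1]≡T²A

  E[-2]≡T⁴A : E (- + 2) ≡₃ T * T * T * T * A
  E[-2]≡T⁴A = cancel₃ {A} {E (- + 2)} {T * T * T * T * A} p∤A (begin
    A * E (- + 2)                    ≈⟨ mod-sym (E-mul -1ℤ -1ℤ) ⟩
    E -1ℤ * E -1ℤ                    ≈⟨ mod-* E[-1]≡T²A E[-1]≡T²A ⟩
    (T * T * A) * (T * T * A)        ≡⟨ regroup T A ⟩
    A * (T * T * T * T * A)          ∎)
    where
      open mod-Reasoning
      regroup : ∀ t a → (t * t * a) * (t * t * a) ≡ a * (t * t * t * t * a)
      regroup = solve-∀

  Qₚ[-2]≡T⁴A : Qₚ (- + 2) ≡₃ T * T * T * T * A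
  Qₚ[-2]≡T⁴A = mod-trans (Qₚ≡E (- + 2)) E[-2]≡T⁴A

  Qₚ[-3]≡T⁶A : Qₚ (- + 3) ≡₃ T * T * T * T * T * T * A
  Qₚ[-3]≡T⁶A = cancel₃ {A} {Qₚ (- + 3)} {T * T * T * T * T * T * A} p∤A (begin
    A * Qₚ (- + 3)                           ≈⟨ mod-*ˡ A (Qₚ≡E (- + 3)) ⟩
    A * E (- + 3)                            ≈⟨ mod-sym (E-mul -1ℤ (- + 2)) ⟩
    E -1ℤ * E (- + 2)                        ≈⟨ mod-* E[-1]≡T²A E[-2]≡T⁴A ⟩
    (T * T * A) * (T * T * T * T * A)        ≡⟨ regroup T A ⟩
    A * (T * T * T * T * T * T * A)          ∎)
    where
      open mod-Reasoning
      regroup : ∀ t a → (t * t * a) * (t * t * t * t * a) ≡ a * (t * t * t * t * t * t * a)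
      regroup = solve-∀

  Qₚ[2]*Qₚ[-2]≡A² : Qₚ (+ 2) * Qₚ (- + 2) ≡₃ A * A
  Qₚ[2]*Qₚ[-2]≡A² = begin
    Qₚ (+ 2) * Qₚ (- + 2)      ≈⟨ mod-* (Qₚ≡E (+ 2)) (Qₚ≡E (- + 2)) ⟩
    E (+ 2) * E (- + 2)        ≈⟨ E-mul (+ 2) (- + 2) ⟩
    A * E 0ℤ                   ≡⟨ cong (A *_) E0≡A ⟩
    A * A                      ∎
    where open mod-Reasoning

  T²*Qₚ[1]≡A : T * T * Qₚ 1ℤ ≡₃ A
  T²*Qₚ[1]≡A = cancel₃ {A} {T * T * Qₚ 1ℤ} {A} p∤A (begin
    A * (T * T * Qₚ 1ℤ)        ≈⟨ mod-*ˡ A (mod-*ˡ (T * T) (Qₚ≡E 1ℤ)) ⟩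
    A * (T * T * E 1ℤ)         ≡⟨ regroup A T (E 1ℤ) ⟩
    (T * T * A) * E 1ℤ         ≈⟨ mod-*ʳ (E 1ℤ) (mod-sym E[-1]≡T²A) ⟩
    E -1ℤ * E 1ℤ               ≈⟨ E-mul -1ℤ 1ℤ ⟩
    A * E 0ℤ                   ≡⟨ cong (A *_) E0≡A ⟩
    A * A                      ∎)
    where
      open mod-Reasoning
      regroup : ∀ a t e → a * (t * t * e) ≡ (t * t * a) * e
      regroup = solve-∀

  +2^n≡[+2]^n : ∀ n → + (2 ℕ.^ n) ≡ (+ 2) ^ n
  +2^n≡[+2]^n zero    = refl
  +2^n≡[+2]^n (suc n) = trans (ℤ.pos-* 2 (2 ℕ.^ n)) (cong (+ 2 *_) (+2^n≡[+2]^n n))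

  +W≡T : + W ≡ T
  +W≡T = trans (+2^n≡[+2]^n (m ℕ.+ m)) (ℤ.^-distribˡ-+-* (+ 2) m m)

  +F₀≡A*εQₚ[-1] : + F₀ ≡ A * (ε * Qₚ -1ℤ)
  +F₀≡A*εQₚ[-1] = trans (+risingProduct≡∏ 0 (m ℕ.+ m)) (trans (∏₂ₘ-halves 0ℤ)
    (cong₂ (λ a y → a * (ε * Q y)) (sym (c₀-lowCoefficients (λ j → + j) m)) (shift P)))
    where
      shift : ∀ P → - 0ℤ - P ≡ -1ℤ * P
      shift = solve-∀

  +F₁≡Qₚ[1]*εQₚ[-2] : + F₁ ≡ Qₚ 1ℤ * (ε * Qₚ (- + 2))
  +F₁≡Qₚ[1]*εQₚ[-2] = trans (+risingProduct≡∏ p (m ℕ.+ m)) (trans (∏₂ₘ-halves P)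
    (cong₂ (λ x y → Q x * (ε * Q y)) (sym (ℤ.*-identityˡ P)) (shift P)))
    where
      shift : ∀ P → - P - P ≡ (- + 2) * P
      shift = solve-∀

  +F₂≡Qₚ[2]*εQₚ[-3] : + F₂ ≡ Qₚ (+ 2) * (ε * Qₚ (- + 3))
  +F₂≡Qₚ[2]*εQₚ[-3] = trans (+risingProduct≡∏ (p ℕ.+ p) (m ℕ.+ m)) (trans (∏₂ₘ-halves (+ (p ℕ.+ p)))
    (cong₂ (λ x y → Q x * (ε * Q y)) (trans (ℤ.pos-+ p p) (double P)) (trans (cong (λ x → - x - P) (ℤ.pos-+ p p)) (shift P))))
    where
      double : ∀ P → P + P ≡ + 2 * P
      double = solve-∀
      shift : ∀ P → - (P + P) - P ≡ (- + 3) * P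
      shift = solve-∀

  +Q₁≡Qₚ[1] : + Q₁ ≡ Qₚ 1ℤ
  +Q₁≡Qₚ[1] = trans (+risingProduct≡∏ p m) (cong Q (sym (ℤ.*-identityˡ P)))

  pos-*-cong : ∀ a b {x y} → + a ≡ x → + b ≡ y → + (a ℕ.* b) ≡ x * y
  pos-*-cong a b a≡x b≡y = trans (ℤ.pos-* a b) (cong₂ _*_ a≡x b≡y)

  +F≡εQₚ : + F ≡ ε * (Qₚ 1ℤ * Qₚ 1ℤ * Qₚ (- + 2) * Qₚ (- + 2) * (Qₚ (+ 2) * Qₚ (- + 3)))
  +F≡εQₚ = begin
    + F                                      ≡⟨ pos-*-cong (F₁ ℕ.* F₁) F₂ (pos-*-cong F₁ F₁ +F₁≡Qₚ[1]*εQₚ[-2] +F₁≡Qₚ[1]*εQₚ[-2])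
                                                           +F₂≡Qₚ[2]*εQₚ[-3] ⟩
    (a * (ε * b)) * (a * (ε * b)) * (c * (ε * d)) ≡⟨ regroup ε a b c d ⟩
    ε * (ε * ε) * (a * a * b * b * (c * d))  ≡⟨ cong (λ x → ε * x * (a * a * b * b * (c * d))) ε*ε≡1 ⟩
    ε * 1ℤ * (a * a * b * b * (c * d))       ≡⟨ cong (_* (a * a * b * b * (c * d))) (ℤ.*-identityʳ ε) ⟩
    ε * (a * a * b * b * (c * d))            ∎
    where
      open ≡-Reasoning
      a = Qₚ 1ℤ
      b = Qₚ (- + 2)
      c = Qₚ (+ 2)
      d = Qₚ (- + 3)
      regroup : ∀ e a b c d → (a * (e * b)) * (a * (e * b)) * (c * (e * d)) ≡ e * (e * e) * (a * a * b * b * (c * d))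
      regroup = solve-∀

  +Z≡T⁷A²Qₚ : + Z ≡ T * T * T * T * T * T * T * (A * A * (Qₚ -1ℤ * Qₚ -1ℤ)) * Qₚ 1ℤ * A
  +Z≡T⁷A²Qₚ = begin
    + Z
        ≡⟨ pos-*-cong (W⁷ ℕ.* F₀ ℕ.* F₀ ℕ.* Q₁) (m !) (pos-*-cong (W⁷ ℕ.* F₀ ℕ.* F₀) Q₁
             (pos-*-cong (W⁷ ℕ.* F₀) F₀ (pos-*-cong W⁷ F₀ +W⁷≡T⁷ +F₀≡A*εQₚ[-1]) +F₀≡A*εQₚ[-1]) +Q₁≡Qₚ[1]) (sym A≡m!) ⟩
    T⁷ * (A * (ε * q)) * (A * (ε * q)) * Qₚ 1ℤ * A
        ≡⟨ cong (λ x → x * Qₚ 1ℤ * A) (regroup T⁷ A ε q) ⟩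
    T⁷ * (ε * ε) * (A * A * (q * q)) * Qₚ 1ℤ * A
        ≡⟨ cong (λ x → T⁷ * x * (A * A * (q * q)) * Qₚ 1ℤ * A) ε*ε≡1 ⟩
    T⁷ * 1ℤ * (A * A * (q * q)) * Qₚ 1ℤ * A
        ≡⟨ cong (λ x → x * (A * A * (q * q)) * Qₚ 1ℤ * A) (ℤ.*-identityʳ T⁷) ⟩
    T⁷ * (A * A * (q * q)) * Qₚ 1ℤ * A  ∎
    where
      open ≡-Reasoning
      q = Qₚ -1ℤ
      T⁷ = T * T * T * T * T * T * T
      +W⁷≡T⁷ : + W⁷ ≡ T⁷
      +W⁷≡T⁷ = pos-*-cong (W ℕ.* W ℕ.* W ℕ.* W ℕ.* W ℕ.* W) W (pos-*-cong (W ℕ.* W ℕ.* W ℕ.* W ℕ.* W) W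
        (pos-*-cong (W ℕ.* W ℕ.* W ℕ.* W) W (pos-*-cong (W ℕ.* W ℕ.* W) W (pos-*-cong (W ℕ.* W) W
        (pos-*-cong W W +W≡T +W≡T) +W≡T) +W≡T) +W≡T) +W≡T) +W≡T
      regroup : ∀ t a e q → t * (a * (e * q)) * (a * (e * q)) ≡ t * (e * e) * (a * a * (q * q))
      regroup = solve-∀

  F≡εT⁶A⁶ : + F ≡₃ ε * (T * T * T * T * T * T * (A * A * A * A * A * A))
  F≡εT⁶A⁶ = begin
    + F                                                     ≡⟨ +F≡εQₚ ⟩
    ε * (a * a * b * b * (c * d))                           ≡⟨ cong (ε *_) (regroup₁ a b c d) ⟩
    ε * (a * a * b * (c * b) * d)                           ≈⟨ mod-*ˡ ε (mod-* (mod-* (mod-*ˡ (a * a) Qₚ[-2]≡T⁴A) Qₚ[2]*Qₚ[-2]≡A²) Qₚ[-3]≡T⁶A) ⟩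
    ε * (a * a * (T * T * T * T * A) * (A * A) * (T * T * T * T * T * T * A))
                                                            ≡⟨ cong (ε *_) (regroup₂ a T A) ⟩
    ε * ((T * T * a) * (T * T * a) * (T * T * T * T * T * T * (A * A * A * A)))
                                                            ≈⟨ mod-*ˡ ε (mod-*ʳ (T * T * T * T * T * T * (A * A * A * A)) (mod-* T²*Qₚ[1]≡A T²*Qₚ[1]≡A)) ⟩
    ε * (A * A * (T * T * T * T * T * T * (A * A * A * A))) ≡⟨ cong (ε *_) (regroup₃ T A) ⟩
    ε * (T * T * T * T * T * T * (A * A * A * A * A * A))   ∎
    where
      open mod-Reasoning
      a = Qₚ 1ℤ
      b = Qₚ (- + 2)
      c = Qₚ (+ 2)
      d = Qₚ (- + 3)
      regroup₁ : ∀ a b c d → a * a * b * b * (c * d) ≡ a * a * b * (c * b) * d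
      regroup₁ = solve-∀
      regroup₂ : ∀ a t x → a * a * (t * t * t * t * x) * (x * x) * (t * t * t * t * t * t * x)
               ≡ (t * t * a) * (t * t * a) * (t * t * t * t * t * t * (x * x * x * x))
      regroup₂ = solve-∀
      regroup₃ : ∀ t x → x * x * (t * t * t * t * t * t * (x * x * x * x)) ≡ t * t * t * t * t * t * (x * x * x * x * x * x)
      regroup₃ = solve-∀

  Z≡T⁹A⁶ : + Z ≡₃ T * T * T * T * T * T * T * T * T * (A * A * A * A * A * A)
  Z≡T⁹A⁶ = begin
    + Z                                                      ≡⟨ +Z≡T⁷A²Qₚ ⟩
    T⁷ * (A * A * (Qₚ -1ℤ * Qₚ -1ℤ)) * Qₚ 1ℤ * A             ≈⟨ mod-*ʳ A (mod-*ʳ (Qₚ 1ℤ) (mod-*ˡ T⁷ (mod-*ˡ (A * A) (mod-* Qₚ[-1]≡T²A Qₚ[-1]≡T²A)))) ⟩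
    T⁷ * (A * A * ((T * T * A) * (T * T * A))) * Qₚ 1ℤ * A   ≡⟨ regroup₁ T A (Qₚ 1ℤ) ⟩
    T * T * T * T * T * T * T * T * T * (A * A * A * A * A) * (T * T * Qₚ 1ℤ)
                                                             ≈⟨ mod-*ˡ (T * T * T * T * T * T * T * T * T * (A * A * A * A * A)) T²*Qₚ[1]≡A ⟩
    T * T * T * T * T * T * T * T * T * (A * A * A * A * A) * A
                                                             ≡⟨ regroup₂ T A ⟩
    T * T * T * T * T * T * T * T * T * (A * A * A * A * A * A) ∎
    where
      open mod-Reasoning
      T⁷ = T * T * T * T * T * T * T
      regroup₁ : ∀ t x a → t * t * t * t * t * t * t * (x * x * ((t * t * x) * (t * t * x))) * a * x
               ≡ t * t * t * t * t * t * t * t * t * (x * x * x * x * x) * (t * t * a)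
      regroup₁ = solve-∀
      regroup₂ : ∀ t x → t * t * t * t * t * t * t * t * t * (x * x * x * x * x) * x
               ≡ t * t * t * t * t * t * t * t * t * (x * x * x * x * x * x)
      regroup₂ = solve-∀

  t : ℤ
  t = + (W ℕ.∸ 1)

  T≡1+t : T ≡ 1ℤ + t
  T≡1+t = trans (sym +W≡T) (trans (cong +_ (sym (ℕ.suc-pred W {{ℕ.>-nonZero (ℕ.m^n>0 2 (m ℕ.+ m))}}))) (ℤ.pos-+ 1 (W ℕ.∸ 1)))

  t≡₁0 : t ≡₁ 0ℤ
  t≡₁0 = subst (_≡₁ 0ℤ) (trans (cong (_- 1ℤ) T≡1+t) (cancel t)) (mod-difference T≡₁1)
    where
      cancel : ∀ t → 1ℤ + t - 1ℤ ≡ t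
      cancel = solve-∀

  F≡εRZ : + F ≡₃ ε * (1ℤ - + 3 * t + + 6 * (t * t)) * + Z
  F≡εRZ = mod-sym (begin
    ε * R * + Z                              ≈⟨ mod-*ˡ (ε * R) Z≡T⁹A⁶ ⟩
    ε * R * (T * T * T * T * T * T * T * T * T * X)  ≡⟨ regroup ε R T X ⟩
    ε * (R * (T * T * T)) * (T * T * T * T * T * T * X)
                                             ≡⟨ cong (λ u → ε * (R * (u * u * u)) * (T * T * T * T * T * T * X)) T≡1+t ⟩
    ε * (R * ((1ℤ + t) * (1ℤ + t) * (1ℤ + t))) * (T * T * T * T * T * T * X)
                                             ≈⟨ mod-*ʳ (T * T * T * T * T * T * X) (mod-*ˡ ε (cube-inverse t≡₁0)) ⟩
    ε * 1ℤ * (T * T * T * T * T * T * X)     ≡⟨ cong (_* (T * T * T * T * T * T * X)) (ℤ.*-identityʳ ε) ⟩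
    ε * (T * T * T * T * T * T * X)          ≈⟨ mod-sym F≡εT⁶A⁶ ⟩
    + F                                      ∎)
    where
      open mod-Reasoning
      R = 1ℤ - + 3 * t + + 6 * (t * t)
      X = A * A * A * A * A * A
      regroup : ∀ e r t x → e * r * (t * t * t * t * t * t * t * t * t * x) ≡ e * (r * (t * t * t)) * (t * t * t * t * t * t * x)
      regroup = solve-∀

  p∤Z : p ∤ Z
  p∤Z = ∤-* (∤-* (∤-* (∤-* p∤W⁷ p∤F₀) p∤F₀) (∤-risingProduct m ℕ.∣-refl m<p)) p∤m!
    where
      p∤W : p ∤ W
      p∤W = ∤-^ p∤2 (m ℕ.+ m)
      p∤W⁷ : p ∤ W⁷
      p∤W⁷ = ∤-* (∤-* (∤-* (∤-* (∤-* (∤-* p∤W p∤W) p∤W) p∤W) p∤W) p∤W) p∤W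
      p∤F₀ : p ∤ F₀
      p∤F₀ = ∤-risingProduct (m ℕ.+ m) (ℕ._∣0 p) ℕ.≤-refl

module Rationals where

  open import Data.Nat as ℕ using (suc)
  import Data.Nat.Properties as ℕ
  open import Data.Integer as ℤ using (ℤ; +_)
  import Data.Integer.Properties as ℤ
  open import Data.Integer.Tactic.RingSolver using (solve-∀)
  import Data.Integer.GCD as ℤ
  open import Data.Rational as ℚ using (ℚ; toℚᵘ; 1ℚ; _+_; _*_; _-_)
  import Data.Rational.Properties as ℚ
  open import Data.Rational.Solver using (module +-*-Solver)
  open import Data.Rational.Unnormalised as ℚᵘ using (mkℚᵘ; *≡*; _≃_)
  import Data.Rational.Unnormalised.Properties as ℚᵘ
  open import Relation.Binary.PropositionalEquality
  open import Defs using (ℤ→ℚ; ℕ→ℚ)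

  toℚᵘ-/ : ∀ i d → toℚᵘ (i ℚ./ suc d) ≃ mkℚᵘ i d
  toℚᵘ-/ i d = *≡* (begin
    ℚᵘ.↥ (toℚᵘ q) ℤ.* + suc d     ≡⟨ cong (ℤ._* + suc d) (ℚ.↥ᵘ-toℚᵘ q) ⟩
    ℚ.↥ q ℤ.* + suc d             ≡⟨ cong (ℚ.↥ q ℤ.*_) (ℚ.↧-/ i (suc d)) ⟨
    ℚ.↥ q ℤ.* (ℚ.↧ q ℤ.* g)       ≡⟨ swap (ℚ.↥ q) (ℚ.↧ q) g ⟩
    ℚ.↥ q ℤ.* g ℤ.* ℚ.↧ q         ≡⟨ cong (ℤ._* ℚ.↧ q) (ℚ.↥-/ i (suc d)) ⟩
    i ℤ.* ℚ.↧ q                   ≡⟨ cong (i ℤ.*_) (ℚ.↧ᵘ-toℚᵘ q) ⟨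
    i ℤ.* ℚᵘ.↧ (toℚᵘ q)           ∎)
    where
      open ≡-Reasoning
      q = i ℚ./ suc d
      g = ℤ.gcd i (+ suc d)
      swap : ∀ a b g → a ℤ.* (b ℤ.* g) ≡ a ℤ.* g ℤ.* b
      swap = solve-∀

  toℚᵘ-ℤ→ℚ : ∀ i → toℚᵘ (ℤ→ℚ i) ≃ mkℚᵘ i 0
  toℚᵘ-ℤ→ℚ i = toℚᵘ-/ i 0

  ℤ→ℚ-+ : ∀ a b → ℤ→ℚ (a ℤ.+ b) ≡ ℤ→ℚ a + ℤ→ℚ b
  ℤ→ℚ-+ a b = ℚ.toℚᵘ-injective (begin
    toℚᵘ (ℤ→ℚ (a ℤ.+ b))             ≈⟨ toℚᵘ-ℤ→ℚ (a ℤ.+ b) ⟩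
    mkℚᵘ (a ℤ.+ b) 0                  ≈⟨ *≡* (distrib a b) ⟩
    mkℚᵘ a 0 ℚᵘ.+ mkℚᵘ b 0            ≈⟨ ℚᵘ.+-cong (toℚᵘ-ℤ→ℚ a) (toℚᵘ-ℤ→ℚ b) ⟨
    toℚᵘ (ℤ→ℚ a) ℚᵘ.+ toℚᵘ (ℤ→ℚ b)    ≈⟨ ℚ.toℚᵘ-homo-+ (ℤ→ℚ a) (ℤ→ℚ b) ⟨
    toℚᵘ (ℤ→ℚ a + ℤ→ℚ b)              ∎)
    where
      open ℚᵘ.≃-Reasoning
      distrib : ∀ a b → (a ℤ.+ b) ℤ.* ℤ.1ℤ ≡ (a ℤ.* ℤ.1ℤ ℤ.+ b ℤ.* ℤ.1ℤ) ℤ.* ℤ.1ℤ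
      distrib = solve-∀

  ℤ→ℚ-* : ∀ a b → ℤ→ℚ (a ℤ.* b) ≡ ℤ→ℚ a * ℤ→ℚ b
  ℤ→ℚ-* a b = ℚ.toℚᵘ-injective (begin
    toℚᵘ (ℤ→ℚ (a ℤ.* b))             ≈⟨ toℚᵘ-ℤ→ℚ (a ℤ.* b) ⟩
    mkℚᵘ (a ℤ.* b) 0                  ≈⟨ ℚᵘ.*-cong (toℚᵘ-ℤ→ℚ a) (toℚᵘ-ℤ→ℚ b) ⟨
    toℚᵘ (ℤ→ℚ a) ℚᵘ.* toℚᵘ (ℤ→ℚ b)    ≈⟨ ℚ.toℚᵘ-homo-* (ℤ→ℚ a) (ℤ→ℚ b) ⟨
    toℚᵘ (ℤ→ℚ a * ℤ→ℚ b)              ∎)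
    where open ℚᵘ.≃-Reasoning

  ℕ→ℚ-* : ∀ a b → ℕ→ℚ (a ℕ.* b) ≡ ℕ→ℚ a * ℕ→ℚ b
  ℕ→ℚ-* a b = trans (cong ℤ→ℚ (ℤ.pos-* a b)) (ℤ→ℚ-* (+ a) (+ b))

  ℤ→ℚ-neg : ∀ a → ℤ→ℚ (ℤ.- a) ≡ ℚ.- ℤ→ℚ a
  ℤ→ℚ-neg a = ℚ.toℚᵘ-injective (begin
    toℚᵘ (ℤ→ℚ (ℤ.- a))     ≈⟨ toℚᵘ-ℤ→ℚ (ℤ.- a) ⟩
    mkℚᵘ (ℤ.- a) 0          ≈⟨ ℚᵘ.-‿cong (toℚᵘ-ℤ→ℚ a) ⟨
    ℚᵘ.- toℚᵘ (ℤ→ℚ a)       ≈⟨ ℚ.toℚᵘ-homo‿- (ℤ→ℚ a) ⟨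
    toℚᵘ (ℚ.- ℤ→ℚ a)        ∎)
    where open ℚᵘ.≃-Reasoning

  /-*-clear : ∀ n z k d .{{_ : ℕ.NonZero d}} → n ℤ.* z ≡ + d ℤ.* k → (n ℚ./ d) * ℤ→ℚ z ≡ ℤ→ℚ k
  /-*-clear n z k (suc d) eq = ℚ.toℚᵘ-injective (begin
    toℚᵘ ((n ℚ./ suc d) * ℤ→ℚ z)            ≈⟨ ℚ.toℚᵘ-homo-* (n ℚ./ suc d) (ℤ→ℚ z) ⟩
    toℚᵘ (n ℚ./ suc d) ℚᵘ.* toℚᵘ (ℤ→ℚ z)    ≈⟨ ℚᵘ.*-cong (toℚᵘ-/ n d) (toℚᵘ-ℤ→ℚ z) ⟩
    mkℚᵘ n d ℚᵘ.* mkℚᵘ z 0                  ≈⟨ *≡* cross ⟩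
    mkℚᵘ k 0                                ≈⟨ toℚᵘ-ℤ→ℚ k ⟨
    toℚᵘ (ℤ→ℚ k)                            ∎)
    where
      open ℚᵘ.≃-Reasoning
      cross : (n ℤ.* z) ℤ.* ℤ.1ℤ ≡ k ℤ.* + (suc d ℕ.* 1)
      cross = trans (ℤ.*-identityʳ (n ℤ.* z)) (trans eq (trans (ℤ.*-comm (+ suc d) k)
                (cong (λ e → k ℤ.* + e) (sym (ℕ.*-identityʳ (suc d))))))

  expansion-error : ∀ (g q z p f e t w c₃ c₆ : ℚ) → g * z ≡ p * f → q * p ≡ t →
    f ≡ e * (1ℚ - c₃ * t + c₆ * (t * t)) * z + w * (p * p * p) →
    (g - e * p * (1ℚ - (c₃ * p) * q + (c₆ * p * p) * (q * q))) * z ≡ (p * p * p * p) * w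
  expansion-error g q z p f e t w c₃ c₆ gz≡pf refl refl = begin
    (g - e * p * (1ℚ - (c₃ * p) * q + (c₆ * p * p) * (q * q))) * z
      ≡⟨ solve 7 (λ g q z p e c₃ c₆ →
           (g :- e :* p :* (con 1ℚ :- (c₃ :* p) :* q :+ (c₆ :* p :* p) :* (q :* q))) :* z
           := g :* z :- e :* p :* z :* (con 1ℚ :- c₃ :* (q :* p) :+ c₆ :* ((q :* p) :* (q :* p))))
           refl g q z p e c₃ c₆ ⟩
    g * z - e * p * z * R                  ≡⟨ cong (_- e * p * z * R) gz≡pf ⟩
    p * (e * R * z + w * (p * p * p)) - e * p * z * R
      ≡⟨ solve 5 (λ p e r z w → p :* (e :* r :* z :+ w :* (p :* p :* p)) :- e :* p :* z :* r
                                 := (p :* p :* p :* p) :* w) refl p e R z w ⟩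
    (p * p * p * p) * w                    ∎
    where
      open ≡-Reasoning
      open +-*-Solver
      R = 1ℚ - c₃ * (q * p) + c₆ * ((q * p) * (q * p))

open import Defs
open import Data.Nat as ℕ using (ℕ; suc; _+_; _*_; _∸_; _/_; _%_; _<_; NonZero; s≤s)

open import Data.Nat.DivMod using (m*n/n≡m; m≡m%n+[m/n]*n; m%n<n)
open import Data.Nat.Divisibility using (divides)
open import Data.Nat.Primality using (Prime; prime⇒irreducible)
open import Data.Nat.Tactic.RingSolver using (solve-∀)
open import Data.Integer as ℤ using (+_)
import Data.Integer.Properties as ℤ
open import Data.Rational as ℚ using ()
open import Data.Product using (Σ; _,_)
open import Data.Sum using (inj₁; inj₂)
open import Relation.Binary.PropositionalEquality
open import Relation.Nullary using (contradiction)
open Congruence using (module PrimeModulus; _≡_[mod_])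
open Rationals

odd-prime : ∀ {p} → Prime p → 3 < p → Σ ℕ λ m → p ≡ suc (m + m)
odd-prime {p} p-prime 3<p with p % 2 | m≡m%n+[m/n]*n p 2 | m%n<n p 2
... | 0 | p≡[p/2]*2 | _ with prime⇒irreducible p-prime (divides (p / 2) p≡[p/2]*2)
...   | inj₁ ()
...   | inj₂ refl = contradiction 3<p λ { (s≤s (s≤s ())) }
odd-prime {p} p-prime 3<p | 1 | p≡1+[p/2]*2 | _ = p / 2 , trans p≡1+[p/2]*2 (cong suc (double (p / 2)))
  where
    double : ∀ n → n * 2 ≡ n + n
    double = solve-∀
odd-prime p-prime 3<p | suc (suc _) | _ | s≤s (s≤s ())

[p+1]/2≡m+1 : ∀ m → (suc (m + m) + 1) / 2 ≡ suc m
[p+1]/2≡m+1 m = trans (cong (_/ 2) (double m)) (m*n/n≡m (suc m) 2)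
  where
    double : ∀ m → suc (m + m) + 1 ≡ suc m * 2
    double = solve-∀

[p-1]/2≡m : ∀ m → (suc (m + m) ∸ 1) / 2 ≡ m
[p-1]/2≡m m = trans (cong (_/ 2) (double m)) (m*n/n≡m m 2)
  where
    double : ∀ m → m + m ≡ m * 2
    double = solve-∀

module _ (m : ℕ) (p-prime : Prime (suc (m + m))) (3<p : 3 < suc (m + m)) where

  open ModuloP³ m p-prime 3<p
  open HalfProducts m using (p; P; ε)
  open Binomials m using (k; Z; F; Gnum*Z≡Gden*p*F)
  open PrimeModulus p-prime using (∤⇒coprime)

  pq Zq Fq e tq : ℚ.ℚ
  pq = ℕ→ℚ p
  Zq = ℕ→ℚ Z
  Fq = ℕ→ℚ F
  e  = ℤ→ℚ ε
  tq = ℤ→ℚ t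

  G*Z≡p*F : G p k ℚ.* Zq ≡ pq ℚ.* Fq
  G*Z≡p*F = trans (/-*-clear (+ Gnum p k) (+ Z) (+ (p * F)) (Gden p k) {{Gden-nonZero p k}}
                    (trans (sym (ℤ.pos-* (Gnum p k) Z)) (trans (cong +_ Gnum*Z≡Gden*p*F) (ℤ.pos-* (Gden p k) (p * F)))))
                  (ℕ→ℚ-* p F)

  q*p≡t : qp2 p ℚ.* pq ≡ tq
  q*p≡t = /-*-clear t (+ p) t p (ℤ.*-comm t (+ p))

  open _≡_[mod_] F≡εRZ renaming (multiple to w; equality to F≡εRZ+wP³)

  c₃ c₆ : ℚ.ℚ
  c₃ = ℕ→ℚ 3
  c₆ = ℕ→ℚ 6

  Fq≡eRZ+wp³ : Fq ≡ e ℚ.* (ℚ.1ℚ ℚ.- c₃ ℚ.* tq ℚ.+ c₆ ℚ.* (tq ℚ.* tq)) ℚ.* Zq ℚ.+ ℤ→ℚ w ℚ.* (pq ℚ.* pq ℚ.* pq)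
  Fq≡eRZ+wp³ = begin
    ℤ→ℚ (+ F)                                          ≡⟨ cong ℤ→ℚ F≡εRZ+wP³ ⟩
    ℤ→ℚ (ε ℤ.* R ℤ.* + Z ℤ.+ w ℤ.* P³)                 ≡⟨ ℤ→ℚ-+ (ε ℤ.* R ℤ.* + Z) (w ℤ.* P³) ⟩
    ℤ→ℚ (ε ℤ.* R ℤ.* + Z) ℚ.+ ℤ→ℚ (w ℤ.* P³)
      ≡⟨ cong₂ ℚ._+_ (trans (ℤ→ℚ-* (ε ℤ.* R) (+ Z)) (cong (ℚ._* Zq) (trans (ℤ→ℚ-* ε R) (cong (e ℚ.*_) R-cast))))
                     (trans (ℤ→ℚ-* w P³) (cong (ℤ→ℚ w ℚ.*_) P³-cast)) ⟩
    e ℚ.* (ℚ.1ℚ ℚ.- c₃ ℚ.* tq ℚ.+ c₆ ℚ.* (tq ℚ.* tq)) ℚ.* Zq ℚ.+ ℤ→ℚ w ℚ.* (pq ℚ.* pq ℚ.* pq) ∎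
    where
      open ≡-Reasoning
      R = ℤ.1ℤ ℤ.- + 3 ℤ.* t ℤ.+ + 6 ℤ.* (t ℤ.* t)
      R-cast : ℤ→ℚ R ≡ ℚ.1ℚ ℚ.- c₃ ℚ.* tq ℚ.+ c₆ ℚ.* (tq ℚ.* tq)
      R-cast = trans (ℤ→ℚ-+ (ℤ.1ℤ ℤ.- + 3 ℤ.* t) (+ 6 ℤ.* (t ℤ.* t))) (cong₂ ℚ._+_
        (trans (ℤ→ℚ-+ ℤ.1ℤ (ℤ.- (+ 3 ℤ.* t))) (cong (ℚ.1ℚ ℚ.+_) (trans (ℤ→ℚ-neg (+ 3 ℤ.* t)) (cong ℚ.-_ (ℤ→ℚ-* (+ 3) t)))))
        (trans (ℤ→ℚ-* (+ 6) (t ℤ.* t)) (cong (c₆ ℚ.*_) (ℤ→ℚ-* t t))))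
      P³-cast : ℤ→ℚ P³ ≡ pq ℚ.* pq ℚ.* pq
      P³-cast = trans (ℤ→ℚ-* (P ℤ.* P) P) (cong (ℚ._* pq) (ℤ→ℚ-* P P))

  p⁴-cast : ℕ→ℚ (p ℕ.^ 4) ≡ pq ℚ.* pq ℚ.* pq ℚ.* pq
  p⁴-cast = trans (cong ℕ→ℚ (fourth p)) (trans (ℕ→ℚ-* (p * p * p) p)
             (cong (ℚ._* pq) (trans (ℕ→ℚ-* (p * p) p) (cong (ℚ._* pq) (ℕ→ℚ-* p p)))))
    where
      fourth : ∀ p → p * (p * (p * (p * 1))) ≡ p * p * p * p
      fourth = solve-∀

  lemma2p4-odd : CongModPow p 4 (G p k)
    (ℤ→ℚ ε ℚ.* pq ℚ.* (ℚ.1ℚ ℚ.- ℕ→ℚ (3 * p) ℚ.* qp2 p ℚ.+ ℕ→ℚ (6 * p * p) ℚ.* (qp2 p ℚ.* qp2 p)))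
  lemma2p4-odd = w , Z , ∤⇒coprime p∤Z , (begin
    (G p k ℚ.- e ℚ.* pq ℚ.* (ℚ.1ℚ ℚ.- ℕ→ℚ (3 * p) ℚ.* q ℚ.+ ℕ→ℚ (6 * p * p) ℚ.* (q ℚ.* q))) ℚ.* Zq
      ≡⟨ cong₂ (λ a b → (G p k ℚ.- e ℚ.* pq ℚ.* (ℚ.1ℚ ℚ.- a ℚ.* q ℚ.+ b ℚ.* (q ℚ.* q))) ℚ.* Zq)
               (ℕ→ℚ-* 3 p) (trans (ℕ→ℚ-* (6 * p) p) (cong (ℚ._* pq) (ℕ→ℚ-* 6 p))) ⟩
    (G p k ℚ.- e ℚ.* pq ℚ.* (ℚ.1ℚ ℚ.- (c₃ ℚ.* pq) ℚ.* q ℚ.+ (c₆ ℚ.* pq ℚ.* pq) ℚ.* (q ℚ.* q))) ℚ.* Zq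
      ≡⟨ expansion-error (G p k) q Zq pq Fq e tq (ℤ→ℚ w) c₃ c₆ G*Z≡p*F q*p≡t Fq≡eRZ+wp³ ⟩
    (pq ℚ.* pq ℚ.* pq ℚ.* pq) ℚ.* ℤ→ℚ w
      ≡⟨ cong (ℚ._* ℤ→ℚ w) p⁴-cast ⟨
    ℕ→ℚ (p ℕ.^ 4) ℚ.* ℤ→ℚ w ∎)
    where
      open ≡-Reasoning
      q = qp2 p

lemma2p4 : (p : ℕ) → .{{_ : NonZero p}} → Prime p → 3 < p →
    CongModPow p 4 (G p ((p + 1) / 2))
    (ℤ→ℚ ((ℤ.- + 1) ℤ.^ ((p ∸ 1) / 2)) ℚ.* ℕ→ℚ p
    ℚ.* (ℚ.1ℚ ℚ.- ℕ→ℚ (3 * p) ℚ.* qp2 p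
    ℚ.+ ℕ→ℚ (6 * p * p) ℚ.* (qp2 p ℚ.* qp2 p)))
lemma2p4 p p-prime 3<p with odd-prime p-prime 3<p
... | m , refl = subst₂ (λ k j → CongModPow p 4 (G p k) (ℤ→ℚ ((ℤ.- + 1) ℤ.^ j) ℚ.* ℕ→ℚ p ℚ.* R))
                        (sym ([p+1]/2≡m+1 m)) (sym ([p-1]/2≡m m)) (lemma2p4-odd m p-prime 3<p)
  where
    R = ℚ.1ℚ ℚ.- ℕ→ℚ (3 * p) ℚ.* qp2 p ℚ.+ ℕ→ℚ (6 * p * p) ℚ.* (qp2 p ℚ.* qp2 p)
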